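{- Let $N$ be a positive integer and $t\ge 1$ a natural number, and let $f=(\mathbb{1}*\mu_{\le N^{1/t}})-\delta_1$. Denote by $f^{*k}$ the $k$-fold Dirichlet convolution of $f$ with itself ($f^{*1}=f$, $f^{*(k+1)}=f^{*k}*f$). Then \[\pi(N)=\sum_{n=1}^N\sum_{k=1}^{t-1}\frac{(-1)^{k-1}}{k}f^{*k}(n)+\pi(N^{1/t})-\sum_{k=2}^{t-1}\frac{1}{k}\left(\pi(N^{1/k})-\pi(N^{1/t})\right).\]
   Context: $*$ denotes Dirichlet convolution: $(f*g)(n)=\sum_{d\mid n}f(d)g(n/d)$. $\mathbb{1}(n)=1$ for all $n$; $\delta_1(n)=1$ if $n=1$ and $0$ otherwise. For $x>0$, $\mu_{\le x}(n)=(-1)^{\omega(n)}$ if $n$ is square-free and all prime factors of $n$ are $\le x$ (including $n=1$), and $0$ otherwise, where $\omega(n)$ is the number of distinct prime divisors of $n$. $\pi(y)$ is the number of primes $\le y$. -}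

module Defs where

open import Data.Nat as ℕ using (ℕ; zero; suc; _^_; _≤?_; _∸_)
open import Data.Nat.Divisibility using (_∣?_)
open import Data.Nat.Primality using (prime?)
open import Data.Nat.DivMod using (_/_)
open import Data.Integer as ℤ using (ℤ; +_)
open import Data.Rational as ℚ using (ℚ; 0ℚ; 1ℚ)
open import Data.List using (List; []; _∷_; filter; length; map; foldr; upTo)
open import Data.Bool using (Bool; true; false; if_then_else_; _∧_; not)
open import Relation.Nullary.Decidable using (⌊_⌋)

allB : {A : Set} → (A → Bool) → List A → Bool
allB P = foldr (λ x b → P x ∧ b) true

ArithFun : Set
ArithFun = ℕ → ℚ

sumℚ : List ℚ → ℚ
sumℚ = foldr ℚ._+_ 0ℚ

-- Σ_{i = a}^{b} g i  (empty if b < a)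
sumFromTo : ℕ → ℕ → (ℕ → ℚ) → ℚ
sumFromTo a b g = sumℚ (map (λ i → g (a ℕ.+ i)) (upTo (suc b ∸ a)))

oneTo : ℕ → List ℕ
oneTo n = map suc (upTo n)

_⋆_ : ArithFun → ArithFun → ArithFun
(f ⋆ g) n = sumℚ (map term (upTo n))
  where
    term : ℕ → ℚ
    term k = if ⌊ suc k ∣? n ⌋ then f (suc k) ℚ.* g (n / suc k) else 0ℚ

δ₁ : ArithFun
δ₁ (suc zero) = 1ℚ
δ₁ _ = 0ℚ

𝟙 : ArithFun
𝟙 _ = 1ℚ

-- k-fold convolution power: f^{*1} = f, f^{*(k+1)} = f^{*k} * f  (f^{*0} := δ₁, unused)
convPow : ArithFun → ℕ → ArithFun
convPow f zero = δ₁
convPow f (suc zero) = f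
convPow f (suc (suc k)) = convPow f (suc k) ⋆ f

primeDivisors : ℕ → List ℕ
primeDivisors n = filter (λ p → prime? p) (filter (λ d → d ∣? n) (oneTo n))

ω : ℕ → ℕ
ω n = length (primeDivisors n)

-- n is square-free: no d ≥ 2 with d² ∣ n  (checking 2 ≤ d ≤ n suffices for n ≥ 1)
squarefree : ℕ → Bool
squarefree n = allB (λ d → not ⌊ d ℕ.* d ∣? n ⌋) (map (2 ℕ.+_) (upTo n))

-- p ≤ N^{1/t}  ⇔  p^t ≤ N  (for natural p, N and t ≥ 1)
leRoot : ℕ → ℕ → ℕ → Bool
leRoot N t p = ⌊ p ^ t ≤? N ⌋

μle : ℕ → ℕ → ArithFun
μle N t n =
  if squarefree n ∧ allB (leRoot N t) (primeDivisors n)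
  then (ℤ.-1ℤ ℤ.^ ω n) ℚ./ 1
  else 0ℚ

-- π(N^{1/k}) = #{ primes p : p^k ≤ N }  (for k ≥ 1 such p satisfy p ≤ N)
πroot : ℕ → ℕ → ℕ
πroot N k = length (filter (λ p → prime? p) (filter (λ p → p ^ k ≤? N) (oneTo N)))

ℕtoℚ : ℕ → ℚ
ℕtoℚ n = (+ n) ℚ./ 1

coeff : ℕ → ℚ
coeff zero = 0ℚ
coeff (suc j) = (ℤ.-1ℤ ℤ.^ j) ℚ./ suc j

inv : ℕ → ℚ
inv zero = 0ℚ
inv (suc j) = (+ 1) ℚ./ suc j

fN : ℕ → ℕ → ArithFun
fN N t n = (𝟙 ⋆ μle N t) n ℚ.- δ₁ n

{-# OPTIONS --safe #-}
module Submission where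

-- With y = N^{1/t}, g = 𝟙 * μ_{≤y} is the indicator of the integers free of primes ≤ y, so
-- f = g - δ₁ lives on integers whose t-th power exceeds N, f^{*k}(n) = 0 for n ≤ N and k ≥ t,
-- and on [1, N] the truncated series c = Σ_{k<t} (-1)^{k-1} f^{*k}/k is the logarithm of g.
-- Logarithms are replaced by the derivations D h(n) = h(n) v_q(n), one for each prime q.
-- The Leibniz rule and a telescoping sum give D c * g = D f on [1, N]; the indicator of the
-- powers of q, weighted by [q > y], also convolves with g to D f.  Cancelling g (g(1) = 1)
-- gives c(n) v_q(n) = [q > y] [n is a power of q], so c(n) = 1/v when n = q^v with q > y
-- prime and c(n) = 0 otherwise.  Summing over n ≤ N counts the prime powers p^v ≤ N with
-- p > y, weighted by 1/v, which is the right-hand side.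

open import Defs
open import Data.Nat using (ℕ; _≥_; _∸_)
open import Data.Rational using (ℚ; _+_; _-_; _*_)
open import Relation.Binary.PropositionalEquality using (_≡_)

open import Data.Nat as N using (zero; suc; _≤_; _<_; z≤n; s≤s; NonZero; _≟_; _≤?_; _<?_)
import Data.Nat.Properties as NP
open import Data.Nat.Divisibility as ND using (_∣_; divides; _∣?_)
open import Data.Nat.DivMod as NDM using (_/_)
open import Data.Nat.Primality as NPr using (Prime; prime?; euclidsLemma)
import Data.Nat.Primality.Factorisation as PF
import Data.Nat.ListAction as NLA
import Data.Nat.Solver
open import Data.Nat.Tactic.RingSolver using (solve)
open import Data.Integer as ℤ using (ℤ; +_)
import Data.Integer.Properties as ZP
open import Data.Rational as ℚ using (0ℚ; 1ℚ; -_)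
import Data.Rational.Properties as QP
import Data.Rational.Unnormalised as U
import Data.Rational.Unnormalised.Properties as UP
import Data.Rational.Solver as QS
open import Algebra.Bundles using (CommutativeMonoid)
open import Algebra.Properties.CommutativeSemigroup (CommutativeMonoid.commutativeSemigroup QP.+-0-commutativeMonoid)
  using () renaming (interchange to +-interchange)
open import Data.List as L using (List; []; _∷_; map; applyUpTo; filter; length)
import Data.List.Properties as LP
open import Data.List.Membership.Propositional using (_∈_)
open import Data.List.Membership.Propositional.Properties using (∈-map⁺; ∈-map⁻; ∈-upTo⁺; ∈-filter⁺; ∈-filter⁻)
open import Data.List.Relation.Unary.Any using (here; there)
import Data.List.Relation.Unary.All as All
open import Data.Bool using (Bool; true; false; if_then_else_; _∧_; not)
open import Data.Bool.Properties using (∧-zeroʳ)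
open import Data.Product using (∃-syntax; _×_; _,_; proj₂)
open import Data.Sum using (_⊎_; inj₁; inj₂; [_,_]′)
open import Data.Empty using (⊥-elim)
open import Function using (id)
open import Relation.Nullary using (¬_; Dec; yes; no)
open import Relation.Nullary.Decidable using (⌊_⌋; _×-dec_; toSum)
open import Relation.Binary.PropositionalEquality using (refl; sym; trans; cong; cong₂; subst; _≢_; module ≡-Reasoning)

module QR = QS.+-*-Solver
module NS = Data.Nat.Solver.+-*-Solver

by-cases : ∀ {P R : Set} → Dec P → (P → R) → (¬ P → R) → R
by-cases d f g = [ f , g ]′ (toSum d)

⌊⌋-true : ∀ {P : Set} (d : Dec P) → P → ⌊ d ⌋ ≡ true
⌊⌋-true (yes _) p = refl
⌊⌋-true (no ¬p) p = ⊥-elim (¬p p)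

⌊⌋-true⇒ : ∀ {P : Set} (d : Dec P) → ⌊ d ⌋ ≡ true → P
⌊⌋-true⇒ (yes p) _ = p

⌊⌋-false : ∀ {P : Set} (d : Dec P) → ¬ P → ⌊ d ⌋ ≡ false
⌊⌋-false (yes p) ¬p = ⊥-elim (¬p p)
⌊⌋-false (no _) ¬p = refl

when : Bool → ℚ → ℚ
when b x = if b then x else 0ℚ

when-yes : ∀ {P : Set} (d : Dec P) → P → ∀ x → when ⌊ d ⌋ x ≡ x
when-yes d p x = cong (λ b → when b x) (⌊⌋-true d p)

when-no : ∀ {P : Set} (d : Dec P) → ¬ P → ∀ x → when ⌊ d ⌋ x ≡ 0ℚ
when-no d ¬p x = cong (λ b → when b x) (⌊⌋-false d ¬p)

when-⇔ : ∀ {P Q : Set} (d : Dec P) (e : Dec Q) → (P → Q) → (Q → P) → ∀ x → when ⌊ d ⌋ x ≡ when ⌊ e ⌋ x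
when-⇔ (yes p) e to from x = sym (when-yes e (to p) x)
when-⇔ (no ¬p) e to from x = sym (when-no e (λ q → ¬p (from q)) x)

when-zero : ∀ b → when b 0ℚ ≡ 0ℚ
when-zero true = refl
when-zero false = refl

when-+ : ∀ b x y → when b (x + y) ≡ when b x + when b y
when-+ true x y = refl
when-+ false x y = refl

when-neg : ∀ b x → when b (- x) ≡ - when b x
when-neg true x = refl
when-neg false x = refl

when-*ˡ : ∀ b x y → y * when b x ≡ when b (y * x)
when-*ˡ true x y = refl
when-*ˡ false x y = QP.*-zeroʳ y

when-*ʳ : ∀ b x y → when b x * y ≡ when b (x * y)
when-*ʳ true x y = refl
when-*ʳ false x y = QP.*-zeroˡ y

when-split : ∀ b x → x ≡ when b x + when (not b) x
when-split true x = sym (QP.+-identityʳ x)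
when-split false x = sym (QP.+-identityˡ x)

*-zeroˡ-≡ : ∀ {x} y → x ≡ 0ℚ → x * y ≡ 0ℚ
*-zeroˡ-≡ y refl = QP.*-zeroˡ y

*-zeroʳ-≡ : ∀ x {y} → y ≡ 0ℚ → x * y ≡ 0ℚ
*-zeroʳ-≡ x refl = QP.*-zeroʳ x

-- Finite sums

∑< : ℕ → (ℕ → ℚ) → ℚ
∑< zero h = 0ℚ
∑< (suc n) h = ∑< n h + h n

syntax ∑< n (λ i → e) = ∑[ i < n ] e

∑-cong : ∀ n {h h' : ℕ → ℚ} → (∀ i → i < n → h i ≡ h' i) → ∑< n h ≡ ∑< n h'
∑-cong zero eq = refl
∑-cong (suc n) eq = cong₂ _+_ (∑-cong n (λ i i<n → eq i (NP.m<n⇒m<1+n i<n))) (eq n NP.≤-refl)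

∑-zero : ∀ n {h : ℕ → ℚ} → (∀ i → i < n → h i ≡ 0ℚ) → ∑< n h ≡ 0ℚ
∑-zero n eq = trans (∑-cong n eq) (∑-const0 n)
  where
  ∑-const0 : ∀ n → ∑[ i < n ] 0ℚ ≡ 0ℚ
  ∑-const0 zero = refl
  ∑-const0 (suc n) = cong (_+ 0ℚ) (∑-const0 n)

∑-+ : ∀ n (h h' : ℕ → ℚ) → ∑[ i < n ] (h i + h' i) ≡ ∑< n h + ∑< n h'
∑-+ zero h h' = refl
∑-+ (suc n) h h' = trans (cong (_+ (h n + h' n)) (∑-+ n h h')) (+-interchange (∑< n h) (∑< n h') (h n) (h' n))

∑-*ˡ : ∀ n c (h : ℕ → ℚ) → ∑[ i < n ] (c * h i) ≡ c * ∑< n h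
∑-*ˡ zero c h = sym (QP.*-zeroʳ c)
∑-*ˡ (suc n) c h = trans (cong (_+ (c * h n)) (∑-*ˡ n c h)) (sym (QP.*-distribˡ-+ c (∑< n h) (h n)))

∑-*ʳ : ∀ n c (h : ℕ → ℚ) → ∑[ i < n ] (h i * c) ≡ ∑< n h * c
∑-*ʳ n c h = trans (∑-cong n (λ i _ → QP.*-comm (h i) c)) (trans (∑-*ˡ n c h) (QP.*-comm c (∑< n h)))

∑-neg : ∀ n (h : ℕ → ℚ) → ∑[ i < n ] (- h i) ≡ - ∑< n h
∑-neg zero h = refl
∑-neg (suc n) h = trans (cong (_+ (- h n)) (∑-neg n h)) (sym (QP.neg-distrib-+ (∑< n h) (h n)))

∑-comm : ∀ n m (F : ℕ → ℕ → ℚ) → ∑[ i < n ] ∑[ j < m ] F i j ≡ ∑[ j < m ] ∑[ i < n ] F i j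
∑-comm zero m F = sym (∑-zero m (λ _ _ → refl))
∑-comm (suc n) m F = trans (cong (_+ ∑< m (F n)) (∑-comm n m F)) (sym (∑-+ m (λ j → ∑[ i < n ] F i j) (F n)))

∑-rotate : ∀ n (F : ℕ → ℕ → ℕ → ℚ) →
  ∑[ x < n ] ∑[ y < n ] ∑[ z < n ] F x y z ≡ ∑[ y < n ] ∑[ z < n ] ∑[ x < n ] F x y z
∑-rotate n F = trans (∑-comm n n _) (∑-cong n (λ y _ → ∑-comm n n _))

∑-suc-front : ∀ n (h : ℕ → ℚ) → ∑< (suc n) h ≡ h 0 + ∑[ i < n ] h (suc i)
∑-suc-front zero h = trans (QP.+-identityˡ (h 0)) (sym (QP.+-identityʳ (h 0)))
∑-suc-front (suc n) h = trans (cong (_+ h (suc n)) (∑-suc-front n h)) (QP.+-assoc (h 0) _ _)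

∑-single : ∀ n x (h : ℕ → ℚ) → x < n → (∀ i → i < n → i ≢ x → h i ≡ 0ℚ) → ∑< n h ≡ h x
∑-single zero x h () eq
∑-single (suc n) x h x<1+n eq with x ≟ n
... | yes refl = trans (cong (_+ h x) (∑-zero n (λ i i<n → eq i (NP.m<n⇒m<1+n i<n) (NP.<⇒≢ i<n))))
                       (QP.+-identityˡ (h x))
... | no x≢n = trans (cong₂ _+_ (∑-single n x h (NP.≤∧≢⇒< (NP.≤-pred x<1+n) x≢n) (λ i i<n → eq i (NP.m<n⇒m<1+n i<n)))
                                (eq n NP.≤-refl (λ e → x≢n (sym e))))
                     (QP.+-identityʳ (h x))

∑-extend : ∀ n m (h : ℕ → ℚ) → n ≤ m → (∀ i → n ≤ i → i < m → h i ≡ 0ℚ) → ∑< m h ≡ ∑< n h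
∑-extend n zero h z≤n eq = refl
∑-extend n (suc m) h n≤1+m eq with n ≟ suc m
... | yes refl = refl
... | no n≢ = trans (cong₂ _+_ (∑-extend n m h n≤m (λ i n≤i i<m → eq i n≤i (NP.m<n⇒m<1+n i<m)))
                               (eq m n≤m NP.≤-refl))
                    (QP.+-identityʳ _)
  where
  n≤m : n ≤ m
  n≤m = NP.≤-pred (NP.≤∧≢⇒< n≤1+m n≢)

∑-≢0 : ∀ n (h : ℕ → ℚ) → ∑< n h ≢ 0ℚ → ∃[ i ] (i < n × h i ≢ 0ℚ)
∑-≢0 zero h ne = ⊥-elim (ne refl)
∑-≢0 (suc n) h ne with h n QP.≟ 0ℚ
... | no hn≢0 = n , NP.≤-refl , hn≢0
... | yes hn≡0 with ∑-≢0 n h (λ z → ne (trans (cong₂ _+_ z hn≡0) (QP.+-identityʳ 0ℚ)))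
... | i , i<n , p = i , NP.m<n⇒m<1+n i<n , p

∑-indicator : ∀ n m (F : ℕ → ℚ) → 1 ≤ m → ∑[ i < n ] when ⌊ m ≟ suc i ⌋ (F (suc i)) ≡ when ⌊ m ≤? n ⌋ (F m)
∑-indicator n (suc m) F _ = by-cases (suc m ≤? n)
  (λ m<n → trans (∑-single n m _ m<n (λ i _ i≢m → when-no (suc m ≟ suc i) (λ e → i≢m (sym (NP.suc-injective e))) _))
                 (trans (when-yes (suc m ≟ suc m) refl _) (sym (when-yes (suc m ≤? n) m<n _))))
  (λ m≮n → trans (∑-zero n (λ i i<n → when-no (suc m ≟ suc i) (λ e → m≮n (subst (_≤ n) (sym e) i<n)) _))
                 (sym (when-no (suc m ≤? n) m≮n _)))

when-∑ : ∀ b n (h : ℕ → ℚ) → when b (∑< n h) ≡ ∑[ i < n ] when b (h i)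
when-∑ true n h = refl
when-∑ false n h = sym (∑-zero n (λ _ _ → refl))

sumℚ-applyUpTo : ∀ n (h : ℕ → ℚ) (g : ℕ → ℕ) → sumℚ (map h (applyUpTo g n)) ≡ ∑[ i < n ] h (g i)
sumℚ-applyUpTo zero h g = refl
sumℚ-applyUpTo (suc n) h g =
  trans (cong (_+_ (h (g 0))) (sumℚ-applyUpTo n h (λ i → g (suc i)))) (sym (∑-suc-front n (λ i → h (g i))))

sumFromTo-1 : ∀ m (g : ℕ → ℚ) → sumFromTo 1 m g ≡ ∑[ i < m ] g (suc i)
sumFromTo-1 m g = sumℚ-applyUpTo m (λ i → g (suc i)) id

sumFromTo-2 : ∀ m (g : ℕ → ℚ) → sumFromTo 2 m g ≡ ∑[ i < m ∸ 1 ] g (suc (suc i))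
sumFromTo-2 m g = sumℚ-applyUpTo (m ∸ 1) (λ i → g (suc (suc i))) id

-- Dirichlet convolution

⋆-unfold : ∀ (a b : ArithFun) n → (a ⋆ b) n ≡ ∑[ k < n ] when ⌊ suc k ∣? n ⌋ (a (suc k) * b (n / suc k))
⋆-unfold a b n = sumℚ-applyUpTo n (λ k → when ⌊ suc k ∣? n ⌋ (a (suc k) * b (n / suc k))) id

∣-indicator : ∀ d n R (G : ℕ → ℚ) .{{_ : NonZero d}} → 1 ≤ n → n ≤ R →
  when ⌊ d ∣? n ⌋ (G (n / d)) ≡ ∑[ j < R ] when ⌊ d N.* suc j ≟ n ⌋ (G (suc j))
∣-indicator d n R G 1≤n n≤R with d ∣? n
... | no d∤n = sym (∑-zero R (λ j _ → when-no (d N.* suc j ≟ n)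
                  (λ e → d∤n (divides (suc j) (trans (sym e) (NP.*-comm d (suc j))))) _))
... | yes (divides zero eq) = ⊥-elim (NP.<-irrefl (sym eq) 1≤n)
... | yes (divides (suc q) eq) = sym (begin
  ∑[ j < R ] when ⌊ d N.* suc j ≟ n ⌋ (G (suc j))
    ≡⟨ ∑-single R q _ q<R (λ j _ j≢q → when-no (d N.* suc j ≟ n) (λ e → j≢q (cofactor-unique j e)) _) ⟩
  when ⌊ d N.* suc q ≟ n ⌋ (G (suc q))
    ≡⟨ when-yes (d N.* suc q ≟ n) (trans (NP.*-comm d (suc q)) (sym eq)) (G (suc q)) ⟩
  G (suc q)
    ≡⟨ cong G (sym (trans (cong (_/ d) eq) (NDM.m*n/n≡m (suc q) d))) ⟩
  G (n / d) ∎)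
  where
  open ≡-Reasoning
  q<R : q < R
  q<R = NP.≤-trans (subst (suc q ≤_) (sym eq) (NP.m≤m*n (suc q) d)) n≤R
  cofactor-unique : ∀ j → d N.* suc j ≡ n → j ≡ q
  cofactor-unique j e = NP.suc-injective (NP.*-cancelˡ-≡ (suc j) (suc q) d (trans e (trans eq (NP.*-comm (suc q) d))))

⋆-as-pairs : ∀ (a b : ArithFun) n R → n ≤ R →
  (a ⋆ b) n ≡ ∑[ i < R ] ∑[ j < R ] when ⌊ suc i N.* suc j ≟ n ⌋ (a (suc i) * b (suc j))
⋆-as-pairs a b zero R _ =
  sym (∑-zero R (λ i _ → ∑-zero R (λ j _ → when-no (suc i N.* suc j ≟ 0) (λ ()) (a (suc i) * b (suc j)))))
⋆-as-pairs a b n@(suc m) R n≤R =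
  trans (⋆-unfold a b n)
  (trans (sym (∑-extend n R _ n≤R (λ i n≤i _ → when-no (suc i ∣? n) (λ i∣n → NP.<-irrefl refl (NP.≤-trans (ND.∣⇒≤ i∣n) n≤i)) _)))
         (∑-cong R (λ i _ → ∣-indicator (suc i) n R (λ e → a (suc i) * b e) (s≤s z≤n) n≤R)))

when-≟-cong : ∀ {x y} n v → x ≡ y → when ⌊ x ≟ n ⌋ v ≡ when ⌊ y ≟ n ⌋ v
when-≟-cong n v refl = refl

⋆-comm : ∀ (a b : ArithFun) n → (a ⋆ b) n ≡ (b ⋆ a) n
⋆-comm a b n = trans (⋆-as-pairs a b n n NP.≤-refl)
  (trans (∑-comm n n _)
  (trans (∑-cong n (λ j _ → ∑-cong n (λ i _ →
            trans (when-≟-cong n _ (NP.*-comm (suc i) (suc j)))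
                  (cong (when ⌊ suc j N.* suc i ≟ n ⌋) (QP.*-comm (a (suc i)) (b (suc j)))))))
  (sym (⋆-as-pairs b a n n NP.≤-refl))))

∑-factor-collapse : ∀ n m k (x c : ℚ) → 1 ≤ m →
  ∑[ i < n ] when ⌊ suc i N.* suc k ≟ n ⌋ (when ⌊ m ≟ suc i ⌋ x * c) ≡ when ⌊ m N.* suc k ≟ n ⌋ (x * c)
∑-factor-collapse n m k x c 1≤m =
  trans (∑-cong n (λ i _ → swap-conditions i))
  (trans (∑-indicator n m (λ _ → when ⌊ m N.* suc k ≟ n ⌋ (x * c)) 1≤m)
         (by-cases (m N.* suc k ≟ n)
           (λ e → when-yes (m ≤? n) (subst (m ≤_) e (NP.m≤m*n m (suc k))) _)
           (λ ne → trans (cong (when ⌊ m ≤? n ⌋) (when-no (m N.* suc k ≟ n) ne _))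
                          (trans (when-zero _) (sym (when-no (m N.* suc k ≟ n) ne _))))))
  where
  swap-conditions : ∀ i → when ⌊ suc i N.* suc k ≟ n ⌋ (when ⌊ m ≟ suc i ⌋ x * c)
                        ≡ when ⌊ m ≟ suc i ⌋ (when ⌊ m N.* suc k ≟ n ⌋ (x * c))
  swap-conditions i with m ≟ suc i
  ... | yes refl = refl
  ... | no _ = trans (cong (when ⌊ suc i N.* suc k ≟ n ⌋) (QP.*-zeroˡ c)) (when-zero _)

⋆-as-triples : ∀ (a b c : ArithFun) n →
  ((a ⋆ b) ⋆ c) n
    ≡ ∑[ x < n ] ∑[ y < n ] ∑[ z < n ] when ⌊ (suc x N.* suc y) N.* suc z ≟ n ⌋ (a (suc x) * b (suc y) * c (suc z))
⋆-as-triples a b c n = begin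
  ((a ⋆ b) ⋆ c) n
    ≡⟨ ⋆-as-pairs (a ⋆ b) c n n NP.≤-refl ⟩
  ∑[ i < n ] ∑[ z < n ] when ⌊ suc i N.* suc z ≟ n ⌋ ((a ⋆ b) (suc i) * c (suc z))
    ≡⟨ ∑-cong n (λ i i<n → ∑-cong n (λ z _ → expand i z i<n)) ⟩
  ∑[ i < n ] ∑[ z < n ] ∑[ x < n ] ∑[ y < n ] F x y z i
    ≡⟨ ∑-cong n (λ i _ → ∑-rotate n (λ z x y → F x y z i)) ⟩
  ∑[ i < n ] ∑[ x < n ] ∑[ y < n ] ∑[ z < n ] F x y z i
    ≡⟨ ∑-comm n n _ ⟩
  ∑[ x < n ] ∑[ i < n ] ∑[ y < n ] ∑[ z < n ] F x y z i
    ≡⟨ ∑-cong n (λ x _ → trans (∑-comm n n _) (∑-cong n (λ y _ → ∑-comm n n _))) ⟩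
  ∑[ x < n ] ∑[ y < n ] ∑[ z < n ] ∑[ i < n ] F x y z i
    ≡⟨ ∑-cong n (λ x _ → ∑-cong n (λ y _ → ∑-cong n (λ z _ →
         ∑-factor-collapse n (suc x N.* suc y) z _ _ (s≤s z≤n)))) ⟩
  ∑[ x < n ] ∑[ y < n ] ∑[ z < n ] when ⌊ (suc x N.* suc y) N.* suc z ≟ n ⌋ (a (suc x) * b (suc y) * c (suc z)) ∎
  where
  open ≡-Reasoning
  F : ℕ → ℕ → ℕ → ℕ → ℚ
  F x y z i = when ⌊ suc i N.* suc z ≟ n ⌋ (when ⌊ suc x N.* suc y ≟ suc i ⌋ (a (suc x) * b (suc y)) * c (suc z))
  expand : ∀ i z → i < n → when ⌊ suc i N.* suc z ≟ n ⌋ ((a ⋆ b) (suc i) * c (suc z)) ≡ ∑[ x < n ] ∑[ y < n ] F x y z i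
  expand i z i<n = begin
    when ⌊ suc i N.* suc z ≟ n ⌋ ((a ⋆ b) (suc i) * c (suc z))
      ≡⟨ cong (λ v → when ⌊ suc i N.* suc z ≟ n ⌋ (v * c (suc z))) (⋆-as-pairs a b (suc i) n i<n) ⟩
    when ⌊ suc i N.* suc z ≟ n ⌋ ((∑[ x < n ] ∑[ y < n ] _) * c (suc z))
      ≡⟨ cong (when ⌊ suc i N.* suc z ≟ n ⌋) (trans (sym (∑-*ʳ n (c (suc z)) _)) (∑-cong n (λ x _ → sym (∑-*ʳ n (c (suc z)) _)))) ⟩
    when ⌊ suc i N.* suc z ≟ n ⌋ (∑[ x < n ] ∑[ y < n ] _)
      ≡⟨ trans (when-∑ _ n _) (∑-cong n (λ x _ → when-∑ _ n _)) ⟩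
    ∑[ x < n ] ∑[ y < n ] F x y z i ∎

⋆-assoc : ∀ (a b c : ArithFun) n → ((a ⋆ b) ⋆ c) n ≡ (a ⋆ (b ⋆ c)) n
⋆-assoc a b c n = begin
  ((a ⋆ b) ⋆ c) n
    ≡⟨ ⋆-as-triples a b c n ⟩
  ∑[ x < n ] ∑[ y < n ] ∑[ z < n ] when ⌊ (suc x N.* suc y) N.* suc z ≟ n ⌋ (a (suc x) * b (suc y) * c (suc z))
    ≡⟨ ∑-rotate n _ ⟩
  ∑[ y < n ] ∑[ z < n ] ∑[ x < n ] when ⌊ (suc x N.* suc y) N.* suc z ≟ n ⌋ (a (suc x) * b (suc y) * c (suc z))
    ≡⟨ ∑-cong n (λ y _ → ∑-cong n (λ z _ → ∑-cong n (λ x _ → rotate-term x y z))) ⟩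
  ∑[ y < n ] ∑[ z < n ] ∑[ x < n ] when ⌊ (suc y N.* suc z) N.* suc x ≟ n ⌋ (b (suc y) * c (suc z) * a (suc x))
    ≡⟨ ⋆-as-triples b c a n ⟨
  ((b ⋆ c) ⋆ a) n
    ≡⟨ ⋆-comm (b ⋆ c) a n ⟩
  (a ⋆ (b ⋆ c)) n ∎
  where
  open ≡-Reasoning
  rotate-term : ∀ x y z →
    when ⌊ (suc x N.* suc y) N.* suc z ≟ n ⌋ (a (suc x) * b (suc y) * c (suc z))
      ≡ when ⌊ (suc y N.* suc z) N.* suc x ≟ n ⌋ (b (suc y) * c (suc z) * a (suc x))
  rotate-term x y z =
    trans (when-≟-cong n _ (trans (NP.*-assoc (suc x) (suc y) (suc z)) (NP.*-comm (suc x) (suc y N.* suc z))))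
          (cong (when _) (trans (QP.*-assoc (a (suc x)) (b (suc y)) (c (suc z))) (QP.*-comm (a (suc x)) _)))

⋆-congˡ : ∀ {a a' : ArithFun} (b : ArithFun) n → (∀ m → a m ≡ a' m) → (a ⋆ b) n ≡ (a' ⋆ b) n
⋆-congˡ {a} {a'} b n eq = trans (⋆-unfold a b n)
  (trans (∑-cong n (λ k _ → cong (λ v → when ⌊ suc k ∣? n ⌋ (v * b (n / suc k))) (eq (suc k))))
         (sym (⋆-unfold a' b n)))

⋆-congʳ : ∀ (a : ArithFun) {b b' : ArithFun} n → (∀ m → b m ≡ b' m) → (a ⋆ b) n ≡ (a ⋆ b') n
⋆-congʳ a {b} {b'} n eq = trans (⋆-comm a b n) (trans (⋆-congˡ a n eq) (⋆-comm b' a n))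

⋆-distribʳ-+ : ∀ (a a' b : ArithFun) n → ((λ m → a m + a' m) ⋆ b) n ≡ (a ⋆ b) n + (a' ⋆ b) n
⋆-distribʳ-+ a a' b n = trans (⋆-unfold (λ m → a m + a' m) b n)
  (trans (∑-cong n (λ k _ → trans (cong (when ⌊ suc k ∣? n ⌋) (QP.*-distribʳ-+ (b (n / suc k)) (a (suc k)) (a' (suc k))))
                                  (when-+ ⌊ suc k ∣? n ⌋ _ _)))
  (trans (∑-+ n _ _) (sym (cong₂ _+_ (⋆-unfold a b n) (⋆-unfold a' b n)))))

⋆-*ˡ : ∀ c (a b : ArithFun) n → ((λ m → c * a m) ⋆ b) n ≡ c * (a ⋆ b) n
⋆-*ˡ c a b n = trans (⋆-unfold (λ m → c * a m) b n)
  (trans (∑-cong n (λ k _ → trans (cong (when ⌊ suc k ∣? n ⌋) (QP.*-assoc c (a (suc k)) (b (n / suc k))))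
                                  (sym (when-*ˡ ⌊ suc k ∣? n ⌋ _ c))))
  (trans (∑-*ˡ n c _) (sym (cong (c *_) (⋆-unfold a b n)))))

⋆-negˡ : ∀ (a b : ArithFun) n → ((λ m → - a m) ⋆ b) n ≡ - (a ⋆ b) n
⋆-negˡ a b n = trans (⋆-unfold (λ m → - a m) b n)
  (trans (∑-cong n (λ k _ → trans (cong (when ⌊ suc k ∣? n ⌋) (sym (QP.neg-distribˡ-* (a (suc k)) (b (n / suc k)))))
                                  (when-neg ⌊ suc k ∣? n ⌋ _)))
  (trans (∑-neg n _) (sym (cong -_ (⋆-unfold a b n)))))

⋆-∑ˡ : ∀ K (A : ℕ → ArithFun) (b : ArithFun) n → ((λ m → ∑[ k < K ] A k m) ⋆ b) n ≡ ∑[ k < K ] (A k ⋆ b) n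
⋆-∑ˡ zero A b n = trans (⋆-unfold (λ _ → 0ℚ) b n)
  (∑-zero n (λ k _ → trans (cong (when ⌊ suc k ∣? n ⌋) (QP.*-zeroˡ (b (n / suc k)))) (when-zero _)))
⋆-∑ˡ (suc K) A b n = trans (⋆-distribʳ-+ (λ m → ∑[ k < K ] A k m) (A K) b n) (cong (_+ (A K ⋆ b) n) (⋆-∑ˡ K A b n))

⋆-identityˡ : ∀ (a : ArithFun) n → a 0 ≡ 0ℚ → (δ₁ ⋆ a) n ≡ a n
⋆-identityˡ a zero a0 = sym a0
⋆-identityˡ a n@(suc m) a0 = begin
  (δ₁ ⋆ a) n
    ≡⟨ trans (⋆-unfold δ₁ a n) (∑-suc-front m _) ⟩
  when ⌊ 1 ∣? n ⌋ (1ℚ * a (n / 1)) + ∑[ k < m ] when ⌊ suc (suc k) ∣? n ⌋ (0ℚ * a (n / suc (suc k)))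
    ≡⟨ cong₂ _+_ (when-yes (1 ∣? n) (ND.1∣ n) _)
                 (∑-zero m (λ k _ → trans (cong (when ⌊ suc (suc k) ∣? n ⌋) (QP.*-zeroˡ (a (n / suc (suc k))))) (when-zero _))) ⟩
  1ℚ * a (n / 1) + 0ℚ
    ≡⟨ trans (QP.+-identityʳ _) (trans (QP.*-identityˡ _) (cong a (NDM.n/1≡n n))) ⟩
  a n ∎
  where open ≡-Reasoning

⋆-≢0 : ∀ (a b : ArithFun) n → (a ⋆ b) n ≢ 0ℚ → ∃[ i ] (suc i ∣ n × a (suc i) ≢ 0ℚ × b (n / suc i) ≢ 0ℚ)
⋆-≢0 a b n ne with ∑-≢0 n _ (λ z → ne (trans (⋆-unfold a b n) z))
... | i , _ , term≢0 with suc i ∣? n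
... | no _ = ⊥-elim (term≢0 refl)
... | yes i∣n = i , i∣n , (λ z → term≢0 (*-zeroˡ-≡ (b (n / suc i)) z)) , (λ z → term≢0 (*-zeroʳ-≡ (a (suc i)) z))

⋆-cancelʳ-zero : ∀ (h g : ArithFun) M → g 1 ≡ 1ℚ → (∀ n → n ≤ M → (h ⋆ g) n ≡ 0ℚ) →
  ∀ n → 1 ≤ n → n ≤ M → h n ≡ 0ℚ
⋆-cancelʳ-zero h g M g1 h⋆g≡0 n 1≤n n≤M = below n n 1≤n NP.≤-refl n≤M
  where
  below : ∀ B n → 1 ≤ n → n ≤ B → n ≤ M → h n ≡ 0ℚ
  below (suc B) n@(suc m) _ (s≤s m≤B) n≤M = begin
    h n
      ≡⟨ sym (trans (cong (h n *_) (trans (cong g (NDM.n/n≡1 n)) g1)) (QP.*-identityʳ (h n))) ⟩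
    h n * g (n / n)
      ≡⟨ sym (trans (cong (_+ when ⌊ n ∣? n ⌋ (h n * g (n / n))) proper-divisors)
                 (trans (QP.+-identityˡ _) (when-yes (n ∣? n) ND.∣-refl (h n * g (n / n))))) ⟩
    ∑[ k < m ] when ⌊ suc k ∣? n ⌋ (h (suc k) * g (n / suc k)) + when ⌊ n ∣? n ⌋ (h n * g (n / n))
      ≡⟨ sym (⋆-unfold h g n) ⟩
    (h ⋆ g) n
      ≡⟨ h⋆g≡0 n n≤M ⟩
    0ℚ ∎
    where
    open ≡-Reasoning
    proper-divisors : ∑[ k < m ] when ⌊ suc k ∣? n ⌋ (h (suc k) * g (n / suc k)) ≡ 0ℚ
    proper-divisors = ∑-zero m (λ k k<m →
      trans (cong (λ v → when ⌊ suc k ∣? n ⌋ (v * g (n / suc k)))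
                  (below B (suc k) (s≤s z≤n) (NP.≤-trans k<m m≤B) (NP.≤-trans (NP.m<n⇒m<1+n k<m) n≤M)))
            (trans (cong (when ⌊ suc k ∣? n ⌋) (QP.*-zeroˡ (g (n / suc k)))) (when-zero _)))

∑-multiples : ∀ n q .{{_ : NonZero q}} (F : ℕ → ℚ) → (∀ d → n < d → F d ≡ 0ℚ) →
  ∑[ k < n ] when ⌊ q ∣? suc k ⌋ (F (suc k)) ≡ ∑[ x < n ] F (q N.* suc x)
∑-multiples n q F vanish = begin
  ∑[ k < n ] when ⌊ q ∣? suc k ⌋ (F (suc k))
    ≡⟨ ∑-cong n (λ k k<n → ∣-indicator q (suc k) n (λ _ → F (suc k)) (s≤s z≤n) k<n) ⟩
  ∑[ k < n ] ∑[ x < n ] when ⌊ q N.* suc x ≟ suc k ⌋ (F (suc k))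
    ≡⟨ ∑-comm n n _ ⟩
  ∑[ x < n ] ∑[ k < n ] when ⌊ q N.* suc x ≟ suc k ⌋ (F (suc k))
    ≡⟨ ∑-cong n (λ x _ → ∑-indicator n (q N.* suc x) F (NP.*-mono-≤ (N.>-nonZero⁻¹ q) (s≤s z≤n))) ⟩
  ∑[ x < n ] when ⌊ q N.* suc x ≤? n ⌋ (F (q N.* suc x))
    ≡⟨ ∑-cong n (λ x _ → by-cases (q N.* suc x ≤? n)
         (λ le → when-yes (q N.* suc x ≤? n) le _)
         (λ gt → trans (when-no (q N.* suc x ≤? n) gt _) (sym (vanish _ (NP.≰⇒> gt))))) ⟩
  ∑[ x < n ] F (q N.* suc x) ∎
  where open ≡-Reasoning

toℚᵘ-/1 : ∀ (z : ℤ) → ℚ.toℚᵘ (z ℚ./ 1) U.≃ U.mkℚᵘ z 0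
toℚᵘ-/1 z = QP.toℚᵘ-fromℚᵘ (U.mkℚᵘ z 0)

ℕtoℚ-suc : ∀ m → ℕtoℚ (suc m) ≡ 1ℚ + ℕtoℚ m
ℕtoℚ-suc m = QP.toℚᵘ-injective (UP.≃-trans (toℚᵘ-/1 (+ suc m))
  (UP.≃-sym (UP.≃-trans (QP.toℚᵘ-homo-+ 1ℚ (ℕtoℚ m))
  (UP.≃-trans (UP.+-cong (UP.≃-refl {ℚ.toℚᵘ 1ℚ}) (toℚᵘ-/1 (+ m)))
              (U.*≡* (cong (ℤ._* (+ 1)) (cong (ℤ._+_ (+ 1)) (ZP.*-identityʳ (+ m)))))))))

ℕtoℚ-+ : ∀ a b → ℕtoℚ (a N.+ b) ≡ ℕtoℚ a + ℕtoℚ b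
ℕtoℚ-+ zero b = sym (QP.+-identityˡ (ℕtoℚ b))
ℕtoℚ-+ (suc a) b = trans (ℕtoℚ-suc (a N.+ b)) (trans (cong (_+_ 1ℚ) (ℕtoℚ-+ a b))
  (trans (sym (QP.+-assoc 1ℚ (ℕtoℚ a) (ℕtoℚ b))) (cong (_+ ℕtoℚ b) (sym (ℕtoℚ-suc a)))))

ℕtoℚ-injective : ∀ a b → ℕtoℚ a ≡ ℕtoℚ b → a ≡ b
ℕtoℚ-injective a b e with UP.≃-trans (UP.≃-sym (toℚᵘ-/1 (+ a))) (UP.≃-trans (QP.toℚᵘ-cong e) (toℚᵘ-/1 (+ b)))
... | U.*≡* eq = ZP.+-injective (trans (sym (ZP.*-identityʳ (+ a))) (trans eq (ZP.*-identityʳ (+ b))))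

∑-const-1 : ∀ n → ∑[ i < n ] 1ℚ ≡ ℕtoℚ n
∑-const-1 zero = refl
∑-const-1 (suc n) = trans (cong (_+ 1ℚ) (∑-const-1 n)) (trans (QP.+-comm (ℕtoℚ n) 1ℚ) (sym (ℕtoℚ-suc n)))

inv-* : ∀ j → inv (suc j) * ℕtoℚ (suc j) ≡ 1ℚ
inv-* j = QP.toℚᵘ-injective (UP.≃-trans (QP.toℚᵘ-homo-* ((+ 1) ℚ./ suc j) ((+ suc j) ℚ./ 1))
  (UP.≃-trans (UP.*-cong (QP.toℚᵘ-fromℚᵘ (U.mkℚᵘ (+ 1) j)) (QP.toℚᵘ-fromℚᵘ (U.mkℚᵘ (+ suc j) 0)))
              (U.*≡* (cong +_ (solve (j ∷ []))))))

*-ℕtoℚ-cancel : ∀ x y v → x * ℕtoℚ (suc v) ≡ y → x ≡ y * inv (suc v)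
*-ℕtoℚ-cancel x y v e = begin
  x                                 ≡⟨ sym (QP.*-identityʳ x) ⟩
  x * 1ℚ                            ≡⟨ cong (x *_) (sym (trans (QP.*-comm (ℕtoℚ (suc v)) (inv (suc v))) (inv-* v))) ⟩
  x * (ℕtoℚ (suc v) * inv (suc v))  ≡⟨ sym (QP.*-assoc x (ℕtoℚ (suc v)) (inv (suc v))) ⟩
  x * ℕtoℚ (suc v) * inv (suc v)    ≡⟨ cong (_* inv (suc v)) e ⟩
  y * inv (suc v)                   ∎
  where open ≡-Reasoning

-≡0⇒≡ : ∀ x y → x - y ≡ 0ℚ → x ≡ y
-≡0⇒≡ x y e = trans (QR.solve 2 (λ x y → x QR.:= (x QR.:- y) QR.:+ y) refl x y) (trans (cong (_+ y) e) (QP.+-identityˡ y))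

sgn : ℕ → ℚ
sgn j = (ℤ.-1ℤ ℤ.^ j) ℚ./ 1

-1ℤ^≡±1 : ∀ j → (ℤ.-1ℤ ℤ.^ j ≡ ℤ.1ℤ) ⊎ (ℤ.-1ℤ ℤ.^ j ≡ ℤ.-1ℤ)
-1ℤ^≡±1 zero = inj₁ refl
-1ℤ^≡±1 (suc j) with -1ℤ^≡±1 j
... | inj₁ e = inj₂ (cong (ℤ.-1ℤ ℤ.*_) e)
... | inj₂ e = inj₁ (cong (ℤ.-1ℤ ℤ.*_) e)

sgn-suc : ∀ j → sgn (suc j) ≡ - sgn j
sgn-suc j with -1ℤ^≡±1 j
... | inj₁ e = trans (cong (λ z → z ℚ./ 1) (cong (ℤ.-1ℤ ℤ.*_) e)) (cong (λ z → - (z ℚ./ 1)) (sym e))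
... | inj₂ e = trans (cong (λ z → z ℚ./ 1) (cong (ℤ.-1ℤ ℤ.*_) e)) (cong (λ z → - (z ℚ./ 1)) (sym e))

coeff-* : ∀ j → coeff (suc j) * ℕtoℚ (suc j) ≡ sgn j
coeff-* j with -1ℤ^≡±1 j
... | inj₁ e = trans (cong (λ z → (z ℚ./ suc j) * ℕtoℚ (suc j)) e) (trans (inv-* j) (cong (λ z → z ℚ./ 1) (sym e)))
... | inj₂ e = trans (cong (λ z → (z ℚ./ suc j) * ℕtoℚ (suc j)) e)
                (trans (sym (QP.neg-distribˡ-* (inv (suc j)) (ℕtoℚ (suc j))))
                (trans (cong -_ (inv-* j)) (cong (λ z → z ℚ./ 1) (sym e))))

∑-sgn-telescope : ∀ T (u : ℕ → ℚ) → ∑[ j < T ] (sgn j * u j) + ∑[ j < T ] (sgn j * u (suc j)) ≡ u 0 - sgn T * u T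
∑-sgn-telescope zero u = sym (trans (cong (_-_ (u 0)) (QP.*-identityˡ (u 0))) (QP.+-inverseʳ (u 0)))
∑-sgn-telescope (suc T) u = begin
  (∑[ j < T ] (sgn j * u j) + sgn T * u T) + (∑[ j < T ] (sgn j * u (suc j)) + sgn T * u (suc T))
    ≡⟨ +-interchange (∑[ j < T ] (sgn j * u j)) (sgn T * u T) (∑[ j < T ] (sgn j * u (suc j))) (sgn T * u (suc T)) ⟩
  (∑[ j < T ] (sgn j * u j) + ∑[ j < T ] (sgn j * u (suc j))) + (sgn T * u T + sgn T * u (suc T))
    ≡⟨ cong (_+ (sgn T * u T + sgn T * u (suc T))) (∑-sgn-telescope T u) ⟩
  (u 0 - sgn T * u T) + (sgn T * u T + sgn T * u (suc T))
    ≡⟨ QR.solve 4 (λ a s x y → (a QR.:- s QR.:* x) QR.:+ (s QR.:* x QR.:+ s QR.:* y) QR.:= a QR.:- (QR.:- s) QR.:* y)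
                  refl (u 0) (sgn T) (u T) (u (suc T)) ⟩
  u 0 - (- sgn T) * u (suc T)
    ≡⟨ cong (λ z → u 0 - z * u (suc T)) (sym (sgn-suc T)) ⟩
  u 0 - sgn (suc T) * u (suc T) ∎
  where open ≡-Reasoning

-- Derivations and the truncated logarithm

Additive : (ℕ → ℚ) → Set
Additive V = ∀ d e → V (suc d N.* suc e) ≡ V (suc d) + V (suc e)

D : (ℕ → ℚ) → ArithFun → ArithFun
D V h n = h n * V n

D-⋆ : ∀ V → Additive V → ∀ (a b : ArithFun) n → D V (a ⋆ b) n ≡ (D V a ⋆ b) n + (a ⋆ D V b) n
D-⋆ V additive a b n = begin
  (a ⋆ b) n * V n
    ≡⟨ cong (_* V n) (⋆-as-pairs a b n n NP.≤-refl) ⟩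
  (∑[ i < n ] ∑[ j < n ] pair a b i j) * V n
    ≡⟨ trans (sym (∑-*ʳ n (V n) _)) (∑-cong n (λ i _ → sym (∑-*ʳ n (V n) _))) ⟩
  ∑[ i < n ] ∑[ j < n ] (pair a b i j * V n)
    ≡⟨ ∑-cong n (λ i _ → ∑-cong n (λ j _ → leibniz i j)) ⟩
  ∑[ i < n ] ∑[ j < n ] (pair (D V a) b i j + pair a (D V b) i j)
    ≡⟨ trans (∑-cong n (λ i _ → ∑-+ n _ _)) (∑-+ n _ _) ⟩
  ∑[ i < n ] ∑[ j < n ] pair (D V a) b i j + ∑[ i < n ] ∑[ j < n ] pair a (D V b) i j
    ≡⟨ sym (cong₂ _+_ (⋆-as-pairs (D V a) b n n NP.≤-refl) (⋆-as-pairs a (D V b) n n NP.≤-refl)) ⟩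
  (D V a ⋆ b) n + (a ⋆ D V b) n ∎
  where
  open ≡-Reasoning
  pair : ArithFun → ArithFun → ℕ → ℕ → ℚ
  pair a' b' i j = when ⌊ suc i N.* suc j ≟ n ⌋ (a' (suc i) * b' (suc j))
  leibniz : ∀ i j → pair a b i j * V n ≡ pair (D V a) b i j + pair a (D V b) i j
  leibniz i j with suc i N.* suc j ≟ n
  ... | yes refl = trans (cong (a (suc i) * b (suc j) *_) (additive i j))
                         (QR.solve 4 (λ x y u w → (x QR.:* y) QR.:* (u QR.:+ w) QR.:= (x QR.:* u) QR.:* y QR.:+ x QR.:* (y QR.:* w))
                                     refl (a (suc i)) (b (suc j)) (V (suc i)) (V (suc j)))
  ... | no _ = QP.*-zeroˡ (V n)

module TruncatedLog (f : ArithFun) (f0 : f 0 ≡ 0ℚ) where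

  convPow-suc : ∀ k n → convPow f (suc k) n ≡ (convPow f k ⋆ f) n
  convPow-suc zero n = sym (⋆-identityˡ f n f0)
  convPow-suc (suc k) n = refl

  convPow-0 : ∀ k → convPow f (suc k) 0 ≡ 0ℚ
  convPow-0 zero = f0
  convPow-0 (suc k) = refl

  log : ℕ → ArithFun
  log T n = ∑[ j < T ] (coeff (suc j) * convPow f (suc j) n)

  module Derivation (V : ℕ → ℚ) (additive : Additive V) where

    Df : ArithFun
    Df = D V f

    Df0 : Df 0 ≡ 0ℚ
    Df0 = *-zeroˡ-≡ (V 0) f0

    convPow-⋆-Df : ∀ k n → ((convPow f k ⋆ Df) ⋆ f) n ≡ (convPow f (suc k) ⋆ Df) n
    convPow-⋆-Df k n = begin
      ((convPow f k ⋆ Df) ⋆ f) n  ≡⟨ ⋆-assoc (convPow f k) Df f n ⟩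
      (convPow f k ⋆ (Df ⋆ f)) n  ≡⟨ ⋆-congʳ (convPow f k) n (λ m → ⋆-comm Df f m) ⟩
      (convPow f k ⋆ (f ⋆ Df)) n  ≡⟨ sym (⋆-assoc (convPow f k) f Df n) ⟩
      ((convPow f k ⋆ f) ⋆ Df) n  ≡⟨ ⋆-congˡ Df n (λ m → sym (convPow-suc k m)) ⟩
      (convPow f (suc k) ⋆ Df) n  ∎
      where open ≡-Reasoning

    D-convPow : ∀ k n → D V (convPow f (suc k)) n ≡ ℕtoℚ (suc k) * (convPow f k ⋆ Df) n
    D-convPow zero n = sym (trans (QP.*-identityˡ _) (⋆-identityˡ Df n Df0))
    D-convPow (suc k) n = begin
      (convPow f (suc k) ⋆ f) n * V n
        ≡⟨ D-⋆ V additive (convPow f (suc k)) f n ⟩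
      (D V (convPow f (suc k)) ⋆ f) n + X
        ≡⟨ cong (_+ X) (trans (⋆-congˡ f n (D-convPow k)) (⋆-*ˡ (ℕtoℚ (suc k)) (convPow f k ⋆ Df) f n)) ⟩
      ℕtoℚ (suc k) * ((convPow f k ⋆ Df) ⋆ f) n + X
        ≡⟨ cong (λ z → ℕtoℚ (suc k) * z + X) (convPow-⋆-Df k n) ⟩
      ℕtoℚ (suc k) * X + X
        ≡⟨ QR.solve 2 (λ c x → c QR.:* x QR.:+ x QR.:= (QR.con 1ℚ QR.:+ c) QR.:* x) refl (ℕtoℚ (suc k)) X ⟩
      (1ℚ + ℕtoℚ (suc k)) * X
        ≡⟨ cong (_* X) (sym (ℕtoℚ-suc (suc k))) ⟩
      ℕtoℚ (suc (suc k)) * X ∎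
      where
      open ≡-Reasoning
      X : ℚ
      X = (convPow f (suc k) ⋆ Df) n

    D-log : ∀ T n → D V (log T) n ≡ ∑[ j < T ] (sgn j * (convPow f j ⋆ Df) n)
    D-log T n = trans (sym (∑-*ʳ T (V n) _)) (∑-cong T (λ j _ → begin
      coeff (suc j) * convPow f (suc j) n * V n
        ≡⟨ QP.*-assoc (coeff (suc j)) (convPow f (suc j) n) (V n) ⟩
      coeff (suc j) * D V (convPow f (suc j)) n
        ≡⟨ cong (coeff (suc j) *_) (D-convPow j n) ⟩
      coeff (suc j) * (ℕtoℚ (suc j) * (convPow f j ⋆ Df) n)
        ≡⟨ sym (QP.*-assoc (coeff (suc j)) (ℕtoℚ (suc j)) _) ⟩
      coeff (suc j) * ℕtoℚ (suc j) * (convPow f j ⋆ Df) n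
        ≡⟨ cong (_* (convPow f j ⋆ Df) n) (coeff-* j) ⟩
      sgn j * (convPow f j ⋆ Df) n ∎))
      where open ≡-Reasoning

    D-log-0 : ∀ T → D V (log T) 0 ≡ 0ℚ
    D-log-0 T = *-zeroˡ-≡ (V 0) (∑-zero T (λ j _ → *-zeroʳ-≡ (coeff (suc j)) (convPow-0 j)))

    D-log-⋆-exp : ∀ T (g : ArithFun) → (∀ m → g m ≡ δ₁ m + f m) → ∀ n →
      (D V (log T) ⋆ g) n ≡ Df n - sgn T * (convPow f T ⋆ Df) n
    D-log-⋆-exp T g g≡δ₁+f n = begin
      (D V (log T) ⋆ g) n
        ≡⟨ trans (⋆-comm (D V (log T)) g n) (⋆-congˡ (D V (log T)) n g≡δ₁+f) ⟩
      ((λ m → δ₁ m + f m) ⋆ D V (log T)) n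
        ≡⟨ ⋆-distribʳ-+ δ₁ f (D V (log T)) n ⟩
      (δ₁ ⋆ D V (log T)) n + (f ⋆ D V (log T)) n
        ≡⟨ cong₂ _+_ (⋆-identityˡ (D V (log T)) n (D-log-0 T)) (⋆-comm f (D V (log T)) n) ⟩
      D V (log T) n + (D V (log T) ⋆ f) n
        ≡⟨ cong₂ _+_ (D-log T n) (trans (⋆-congˡ f n (D-log T))
             (trans (⋆-∑ˡ T (λ j m → sgn j * (convPow f j ⋆ Df) m) f n)
                    (∑-cong T (λ j _ → trans (⋆-*ˡ (sgn j) (convPow f j ⋆ Df) f n)
                                             (cong (sgn j *_) (convPow-⋆-Df j n)))))) ⟩
      ∑[ j < T ] (sgn j * (convPow f j ⋆ Df) n) + ∑[ j < T ] (sgn j * (convPow f (suc j) ⋆ Df) n)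
        ≡⟨ ∑-sgn-telescope T (λ j → (convPow f j ⋆ Df) n) ⟩
      (δ₁ ⋆ Df) n - sgn T * (convPow f T ⋆ Df) n
        ≡⟨ cong (_- sgn T * (convPow f T ⋆ Df) n) (⋆-identityˡ Df n Df0) ⟩
      Df n - sgn T * (convPow f T ⋆ Df) n ∎
      where open ≡-Reasoning

-- Primes, prime powers and valuations

prime⇒≥2 : ∀ {p} → Prime p → 2 ≤ p
prime⇒≥2 {p} pp = N.nonTrivial⇒n>1 p {{NPr.prime⇒nonTrivial pp}}

prime∣prime⇒≡ : ∀ {p q} → Prime p → Prime q → p ∣ q → p ≡ q
prime∣prime⇒≡ pp pq p∣q =
  [ (λ p≡1 → ⊥-elim (NPr.¬prime[1] (subst Prime p≡1 pp))) , id ]′ (NPr.prime⇒irreducible pq p∣q)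

prime∣^⇒≡ : ∀ {p q} k → Prime p → Prime q → p ∣ q N.^ k → p ≡ q
prime∣^⇒≡ zero pp pq p∣1 = ⊥-elim (NPr.¬prime[1] (subst Prime (ND.∣1⇒≡1 p∣1) pp))
prime∣^⇒≡ {q = q} (suc k) pp pq p∣q^k+1 with euclidsLemma q (q N.^ k) pp p∣q^k+1
... | inj₁ p∣q = prime∣prime⇒≡ pp pq p∣q
... | inj₂ p∣q^k = prime∣^⇒≡ k pp pq p∣q^k

∃-prime-factor : ∀ n → 2 ≤ n → ∃[ p ] (Prime p × p ∣ n)
∃-prime-factor (suc zero) (s≤s ())
∃-prime-factor n@(suc (suc _)) _ = head-factor (PF.factorise n)
  where
  head-factor : PF.PrimeFactorisation n → ∃[ p ] (Prime p × p ∣ n)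
  head-factor record { factors = [] ; isFactorisation = () }
  head-factor record { factors = p ∷ ps ; isFactorisation = n≡p*ps ; factorsPrime = pp All.∷ _ } =
    p , pp , divides (NLA.product ps) (trans n≡p*ps (NP.*-comm p (NLA.product ps)))

n<m^n : ∀ {m} → 2 ≤ m → ∀ n → n < m N.^ n
n<m^n m≥2 zero = s≤s z≤n
n<m^n {m} m≥2 (suc n) = begin
  suc (suc n)  ≡⟨ cong suc (NP.+-comm 1 n) ⟩
  suc n N.+ 1  ≤⟨ NP.+-mono-≤ ih (NP.≤-trans (s≤s z≤n) ih) ⟩
  x N.+ x      ≡⟨ cong (x N.+_) (sym (NP.+-identityʳ x)) ⟩
  2 N.* x      ≤⟨ NP.*-monoˡ-≤ x m≥2 ⟩
  m N.* x      ∎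
  where
  open NP.≤-Reasoning
  x : ℕ
  x = m N.^ n
  ih : suc n ≤ x
  ih = n<m^n m≥2 n

^-distribʳ-* : ∀ a b k → (a N.* b) N.^ k ≡ a N.^ k N.* b N.^ k
^-distribʳ-* a b zero = refl
^-distribʳ-* a b (suc k) = trans (cong ((a N.* b) N.*_) (^-distribʳ-* a b k))
  (NS.solve 4 (λ a b x y → (a NS.:* b) NS.:* (x NS.:* y) NS.:= (a NS.:* x) NS.:* (b NS.:* y)) refl a b (a N.^ k) (b N.^ k))

1≤-factorʳ : ∀ {x} y {m} → suc x ≡ y N.* m → 1 ≤ m
1≤-factorʳ y {zero} e = ⊥-elim (NP.<-irrefl (sym (trans e (NP.*-zeroʳ y))) (s≤s z≤n))
1≤-factorʳ y {suc m} e = s≤s z≤n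

PowerSplit : ℕ → ℕ → Set
PowerSplit q n = ∃[ v ] ∃[ m ] (n ≡ q N.^ v N.* m × ¬ q ∣ m)

powerSplit : ∀ {q} → Prime q → ∀ n → 1 ≤ n → PowerSplit q n
powerSplit {q} pq n 1≤n = split n n 1≤n NP.≤-refl
  where
  split : ∀ B n → 1 ≤ n → n ≤ B → PowerSplit q n
  split B n 1≤n n≤B with q ∣? n
  ... | no q∤n = 0 , n , sym (NP.+-identityʳ n) , q∤n
  split zero n 1≤n n≤B | yes _ = ⊥-elim (NP.<-irrefl refl (NP.≤-trans 1≤n n≤B))
  split (suc B) n 1≤n n≤B | yes (divides zero eq) = ⊥-elim (NP.<-irrefl (sym eq) 1≤n)
  split (suc B) n 1≤n n≤B | yes (divides (suc k) eq)
    with split B (suc k) (s≤s z≤n) (NP.≤-pred (NP.≤-trans (subst (suc (suc k) ≤_) (sym eq) shrinks) n≤B))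
    where
    shrinks : suc (suc k) ≤ suc k N.* q
    shrinks = NP.≤-trans (s≤s (s≤s (NP.m≤m*n k 2))) (NP.*-monoʳ-≤ (suc k) (prime⇒≥2 pq))
  ... | v , m , e , q∤m = suc v , m , trans eq (trans (cong (N._* q) e)
          (NS.solve 3 (λ a b c → (a NS.:* b) NS.:* c NS.:= (c NS.:* a) NS.:* b) refl (q N.^ v) m q)) , q∤m

^∣^*⇒≤ : ∀ {q m} → Prime q → ¬ q ∣ m → ∀ j v → q N.^ j ∣ q N.^ v N.* m → j ≤ v
^∣^*⇒≤ pq q∤m zero v _ = z≤n
^∣^*⇒≤ {q} {m} pq q∤m (suc j) zero d =
  ⊥-elim (q∤m (ND.∣-trans (ND.m∣m*n (q N.^ j)) (subst (q N.^ suc j ∣_) (NP.*-identityˡ m) d)))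
^∣^*⇒≤ {q} {m} pq q∤m (suc j) (suc v) d = s≤s (^∣^*⇒≤ pq q∤m j v
  (ND.*-cancelˡ-∣ q {{NPr.prime⇒nonZero pq}} (subst (q N.^ suc j ∣_) (NP.*-assoc q (q N.^ v) m) d)))

≤⇒^∣^* : ∀ {q m} j v → j ≤ v → q N.^ j ∣ q N.^ v N.* m
≤⇒^∣^* zero v _ = ND.1∣ _
≤⇒^∣^* {q} {m} (suc j) (suc v) (s≤s j≤v) =
  subst (q N.^ suc j ∣_) (sym (NP.*-assoc q (q N.^ v) m)) (ND.*-monoʳ-∣ q (≤⇒^∣^* j v j≤v))

^-injective : ∀ {q} → Prime q → ∀ a b → q N.^ a ≡ q N.^ b → a ≡ b
^-injective {q} pq a b e =
  NP.≤-antisym (^∣^*⇒≤ pq q∤1 a b (subst (q N.^ a ∣_) (trans e (sym (NP.*-identityʳ _))) ND.∣-refl))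
               (^∣^*⇒≤ pq q∤1 b a (subst (q N.^ b ∣_) (trans (sym e) (sym (NP.*-identityʳ _))) ND.∣-refl))
  where
  q∤1 : ¬ q ∣ 1
  q∤1 d = NP.<-irrefl (sym (ND.∣1⇒≡1 d)) (prime⇒≥2 pq)

prime²∣*⇒∣ : ∀ {r q x} → Prime r → Prime q → r ≢ q → r N.* r ∣ q N.* x → r N.* r ∣ x
prime²∣*⇒∣ {r} {q} {x} pr pq r≢q d with euclidsLemma q x pr (ND.∣-trans (ND.m∣m*n r) d)
... | inj₁ r∣q = ⊥-elim (r≢q (prime∣prime⇒≡ pr pq r∣q))
... | inj₂ (divides y x≡yr) with euclidsLemma q y pr (ND.*-cancelˡ-∣ r {{NPr.prime⇒nonZero pr}} d')
  where
  d' : r N.* r ∣ r N.* (q N.* y)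
  d' = subst (r N.* r ∣_) (trans (cong (q N.*_) x≡yr) (NS.solve 3 (λ q y r → q NS.:* (y NS.:* r) NS.:= r NS.:* (q NS.:* y)) refl q y r)) d
... | inj₁ r∣q = ⊥-elim (r≢q (prime∣prime⇒≡ pr pq r∣q))
... | inj₂ (divides z y≡zr) = divides z (trans x≡yr (trans (cong (N._* r) y≡zr) (NP.*-assoc z r r)))

ν : ℕ → ℕ → ℚ
ν q n = ∑[ j < n ] when ⌊ q N.^ suc j ∣? n ⌋ 1ℚ

ν-power-split : ∀ {q} → Prime q → ∀ v m → ¬ q ∣ m → 1 ≤ m → ν q (q N.^ v N.* m) ≡ ℕtoℚ v
ν-power-split {q} pq v m q∤m 1≤m = begin
  ν q n
    ≡⟨ ∑-cong n (λ j _ → when-⇔ (q N.^ suc j ∣? n) (suc j ≤? v) (^∣^*⇒≤ pq q∤m (suc j) v) (≤⇒^∣^* (suc j) v) 1ℚ) ⟩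
  ∑[ j < n ] when ⌊ suc j ≤? v ⌋ 1ℚ
    ≡⟨ ∑-extend v n _ v≤n (λ j v≤j _ → when-no (suc j ≤? v) (λ j<v → NP.<-irrefl refl (NP.≤-trans j<v v≤j)) 1ℚ) ⟩
  ∑[ j < v ] when ⌊ suc j ≤? v ⌋ 1ℚ
    ≡⟨ ∑-cong v (λ j j<v → when-yes (suc j ≤? v) j<v 1ℚ) ⟩
  ∑[ j < v ] 1ℚ
    ≡⟨ ∑-const-1 v ⟩
  ℕtoℚ v ∎
  where
  open ≡-Reasoning
  n : ℕ
  n = q N.^ v N.* m
  v≤n : v ≤ n
  v≤n = NP.<⇒≤ (NP.<-≤-trans (n<m^n (prime⇒≥2 pq) v) (NP.m≤m*n (q N.^ v) m {{N.>-nonZero 1≤m}}))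

ν-additive : ∀ {q} → Prime q → Additive (ν q)
ν-additive {q} pq d e with powerSplit pq (suc d) (s≤s z≤n) | powerSplit pq (suc e) (s≤s z≤n)
... | a , m , d≡ , q∤m | b , m' , e≡ , q∤m' = begin
  ν q (suc d N.* suc e)                    ≡⟨ cong (ν q) product ⟩
  ν q (q N.^ (a N.+ b) N.* (m N.* m'))     ≡⟨ ν-power-split pq (a N.+ b) (m N.* m') q∤mm' (NP.*-mono-≤ 1≤m 1≤m') ⟩
  ℕtoℚ (a N.+ b)                           ≡⟨ ℕtoℚ-+ a b ⟩
  ℕtoℚ a + ℕtoℚ b                          ≡⟨ sym (cong₂ _+_ (trans (cong (ν q) d≡) (ν-power-split pq a m q∤m 1≤m))
                                                              (trans (cong (ν q) e≡) (ν-power-split pq b m' q∤m' 1≤m'))) ⟩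
  ν q (suc d) + ν q (suc e)                ∎
  where
  open ≡-Reasoning
  1≤m : 1 ≤ m
  1≤m = 1≤-factorʳ (q N.^ a) d≡
  1≤m' : 1 ≤ m'
  1≤m' = 1≤-factorʳ (q N.^ b) e≡
  q∤mm' : ¬ q ∣ m N.* m'
  q∤mm' q∣mm' = [ q∤m , q∤m' ]′ (euclidsLemma m m' pq q∣mm')
  product : suc d N.* suc e ≡ q N.^ (a N.+ b) N.* (m N.* m')
  product = trans (cong₂ N._*_ d≡ e≡)
    (trans (NS.solve 4 (λ x m y m' → (x NS.:* m) NS.:* (y NS.:* m') NS.:= (x NS.:* y) NS.:* (m NS.:* m')) refl (q N.^ a) m (q N.^ b) m')
           (cong (N._* (m N.* m')) (sym (NP.^-distribˡ-+-* q a b))))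

ν-∤ : ∀ q n → ¬ q ∣ n → ν q n ≡ 0ℚ
ν-∤ q n q∤n = ∑-zero n (λ j _ → when-no (q N.^ suc j ∣? n) (λ d → q∤n (ND.∣-trans (ND.m∣m*n (q N.^ j)) d)) 1ℚ)

ν-1 : ∀ {q} → Prime q → ν q 1 ≡ 0ℚ
ν-1 pq = ν-∤ _ 1 (λ q∣1 → NP.<-irrefl (sym (ND.∣1⇒≡1 q∣1)) (prime⇒≥2 pq))

allB-true⇒ : ∀ {A : Set} (P : A → Bool) xs → allB P xs ≡ true → ∀ {x} → x ∈ xs → P x ≡ true
allB-true⇒ P (y ∷ ys) h x∈ with P y in Py≡
allB-true⇒ P (y ∷ ys) h (here refl) | true = Py≡
allB-true⇒ P (y ∷ ys) h (there x∈) | true = allB-true⇒ P ys h x∈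

allB-true⇐ : ∀ {A : Set} (P : A → Bool) xs → (∀ {x} → x ∈ xs → P x ≡ true) → allB P xs ≡ true
allB-true⇐ P [] h = refl
allB-true⇐ P (y ∷ ys) h = cong₂ _∧_ (h (here refl)) (allB-true⇐ P ys (λ x∈ → h (there x∈)))

true⇔true⇒≡ : ∀ {a b} → (a ≡ true → b ≡ true) → (b ≡ true → a ≡ true) → a ≡ b
true⇔true⇒≡ {true} {true} to from = refl
true⇔true⇒≡ {true} {false} to from = sym (to refl)
true⇔true⇒≡ {false} {true} to from = from refl
true⇔true⇒≡ {false} {false} to from = refl

¬true⇒false : ∀ b → ¬ (b ≡ true) → b ≡ false
¬true⇒false true ne = ⊥-elim (ne refl)
¬true⇒false false ne = refl

∈-oneTo⁺ : ∀ {n p} → 1 ≤ p → p ≤ n → p ∈ oneTo n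
∈-oneTo⁺ {p = suc i} _ i<n = ∈-map⁺ suc (∈-upTo⁺ i<n)

∈-primeDivisors⁺ : ∀ {p n} → Prime p → p ∣ n → 1 ≤ n → p ∈ primeDivisors n
∈-primeDivisors⁺ {p} {n} pp p∣n 1≤n =
  ∈-filter⁺ (λ p → prime? p) (∈-filter⁺ (λ d → d ∣? n) (∈-oneTo⁺ (NP.≤-trans (s≤s z≤n) (prime⇒≥2 pp)) (ND.∣⇒≤ {{N.>-nonZero 1≤n}} p∣n)) p∣n) pp

∈-primeDivisors⁻ : ∀ {p n} → p ∈ primeDivisors n → Prime p × p ∣ n
∈-primeDivisors⁻ {p} {n} p∈ with ∈-filter⁻ (λ p → prime? p) {xs = filter (λ d → d ∣? n) (oneTo n)} p∈
... | p∈' , pp = pp , proj₂ (∈-filter⁻ (λ d → d ∣? n) {xs = oneTo n} p∈')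

squarefree⇒ : ∀ {n d} → 1 ≤ n → squarefree n ≡ true → 2 ≤ d → ¬ d N.* d ∣ n
squarefree⇒ {d = zero} _ _ ()
squarefree⇒ {d = suc zero} _ _ (s≤s ())
squarefree⇒ {n} {d@(suc (suc i))} 1≤n sf _ d²∣n = false≢true (trans (sym (cong not (⌊⌋-true (d N.* d ∣? n) d²∣n)))
  (allB-true⇒ (λ e → not ⌊ e N.* e ∣? n ⌋) (L.map (2 N.+_) (L.upTo n)) sf d∈))
  where
  false≢true : false ≢ true
  false≢true ()
  d≤n : d ≤ n
  d≤n = NP.≤-trans (NP.m≤m*n d d) (ND.∣⇒≤ {{N.>-nonZero 1≤n}} d²∣n)
  d∈ : d ∈ L.map (2 N.+_) (L.upTo n)
  d∈ = ∈-map⁺ (2 N.+_) (∈-upTo⁺ (NP.≤-trans (NP.n≤1+n (suc i)) d≤n))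

squarefree⇐ : ∀ {n} → (∀ d → 2 ≤ d → ¬ d N.* d ∣ n) → squarefree n ≡ true
squarefree⇐ {n} h = allB-true⇐ (λ e → not ⌊ e N.* e ∣? n ⌋) (L.map (2 N.+_) (L.upTo n)) no-square
  where
  no-square : ∀ {d} → d ∈ L.map (2 N.+_) (L.upTo n) → not ⌊ d N.* d ∣? n ⌋ ≡ true
  no-square d∈ with ∈-map⁻ (2 N.+_) d∈
  ... | i , _ , refl = cong not (⌊⌋-false (_ ∣? n) (h (2 N.+ i) (s≤s (s≤s z≤n))))

ℕtoℚ-length : ∀ {A : Set} (xs : List A) → ℕtoℚ (length xs) ≡ sumℚ (map (λ _ → 1ℚ) xs)
ℕtoℚ-length [] = refl
ℕtoℚ-length (x ∷ xs) = trans (ℕtoℚ-suc (length xs)) (cong (_+_ 1ℚ) (ℕtoℚ-length xs))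

sumℚ-filter : ∀ {A : Set} (w : A → ℚ) {Q : A → Set} (Q? : ∀ x → Dec (Q x)) xs →
  sumℚ (map w (filter Q? xs)) ≡ sumℚ (map (λ y → when ⌊ Q? y ⌋ (w y)) xs)
sumℚ-filter w Q? [] = refl
sumℚ-filter w Q? (x ∷ xs) = by-cases (Q? x)
  (λ q → trans (cong (λ l → sumℚ (map w l)) (LP.filter-accept Q? q))
               (cong₂ _+_ (sym (when-yes (Q? x) q (w x))) (sumℚ-filter w Q? xs)))
  (λ ¬q → trans (cong (λ l → sumℚ (map w l)) (LP.filter-reject Q? ¬q))
                (trans (sym (QP.+-identityˡ _)) (cong₂ _+_ (sym (when-no (Q? x) ¬q (w x))) (sumℚ-filter w Q? xs))))

count-oneTo : ∀ {R Q : ℕ → Set} (R? : ∀ x → Dec (R x)) (Q? : ∀ x → Dec (Q x)) n →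
  ℕtoℚ (length (filter Q? (filter R? (oneTo n)))) ≡ ∑[ i < n ] when ⌊ R? (suc i) ⌋ (when ⌊ Q? (suc i) ⌋ 1ℚ)
count-oneTo R? Q? n = begin
  ℕtoℚ (length (filter Q? (filter R? (oneTo n))))
    ≡⟨ ℕtoℚ-length (filter Q? (filter R? (oneTo n))) ⟩
  sumℚ (map (λ _ → 1ℚ) (filter Q? (filter R? (oneTo n))))
    ≡⟨ sumℚ-filter (λ _ → 1ℚ) Q? (filter R? (oneTo n)) ⟩
  sumℚ (map (λ y → when ⌊ Q? y ⌋ 1ℚ) (filter R? (oneTo n)))
    ≡⟨ sumℚ-filter (λ y → when ⌊ Q? y ⌋ 1ℚ) R? (oneTo n) ⟩
  sumℚ (map (λ y → when ⌊ R? y ⌋ (when ⌊ Q? y ⌋ 1ℚ)) (oneTo n))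
    ≡⟨ cong (λ l → sumℚ (map (λ y → when ⌊ R? y ⌋ (when ⌊ Q? y ⌋ 1ℚ)) l)) (LP.map-applyUpTo id suc n) ⟩
  sumℚ (map (λ y → when ⌊ R? y ⌋ (when ⌊ Q? y ⌋ 1ℚ)) (applyUpTo suc n))
    ≡⟨ sumℚ-applyUpTo n _ suc ⟩
  ∑[ i < n ] when ⌊ R? (suc i) ⌋ (when ⌊ Q? (suc i) ⌋ 1ℚ) ∎
  where open ≡-Reasoning

-- The Möbius function restricted to small primes

module Rough (N t : ℕ) where

  Small : ℕ → Set
  Small p = p N.^ t ≤ N

  allSmall : ℕ → Bool
  allSmall n = allB (leRoot N t) (primeDivisors n)

  allSmall⇒ : ∀ {n p} → 1 ≤ n → allSmall n ≡ true → Prime p → p ∣ n → Small p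
  allSmall⇒ {n} {p} 1≤n h pp p∣n =
    ⌊⌋-true⇒ (p N.^ t ≤? N) (allB-true⇒ (leRoot N t) (primeDivisors n) h (∈-primeDivisors⁺ pp p∣n 1≤n))

  allSmall⇐ : ∀ {n} → (∀ p → Prime p → p ∣ n → Small p) → allSmall n ≡ true
  allSmall⇐ {n} h = allB-true⇐ (leRoot N t) (primeDivisors n) small
    where
    small : ∀ {p} → p ∈ primeDivisors n → leRoot N t p ≡ true
    small {p} p∈ with ∈-primeDivisors⁻ p∈
    ... | pp , p∣n = ⌊⌋-true (p N.^ t ≤? N) (h p pp p∣n)

  μ : ArithFun
  μ = μle N t

  g : ArithFun
  g = 𝟙 ⋆ μ

  μ-not-allSmall : ∀ d → allSmall d ≡ false → μ d ≡ 0ℚ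
  μ-not-allSmall d e = trans (cong (λ b → when (squarefree d ∧ b) (sgn (ω d))) e)
                             (cong (λ b → when b (sgn (ω d))) (∧-zeroʳ (squarefree d)))

  μ-q*-∣ : ∀ {q} x → Prime q → 1 ≤ x → q ∣ x → μ (q N.* x) ≡ 0ℚ
  μ-q*-∣ {q} x pq 1≤x q∣x = cong (λ b → when (b ∧ allSmall (q N.* x)) (sgn (ω (q N.* x)))) not-squarefree
    where
    not-squarefree : squarefree (q N.* x) ≡ false
    not-squarefree = ¬true⇒false _ (λ sf → squarefree⇒ (NP.*-mono-≤ (NP.≤-trans (s≤s z≤n) (prime⇒≥2 pq)) 1≤x) sf
                                                       (prime⇒≥2 pq) (ND.*-monoʳ-∣ q q∣x))

  squarefree-q* : ∀ {q} x → Prime q → 1 ≤ x → ¬ q ∣ x → squarefree (q N.* x) ≡ squarefree x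
  squarefree-q* {q} x pq 1≤x q∤x = true⇔true⇒≡ to from
    where
    1≤qx : 1 ≤ q N.* x
    1≤qx = NP.*-mono-≤ (NP.≤-trans (s≤s z≤n) (prime⇒≥2 pq)) 1≤x
    to : squarefree (q N.* x) ≡ true → squarefree x ≡ true
    to sf = squarefree⇐ (λ d 2≤d d²∣x → squarefree⇒ 1≤qx sf 2≤d (ND.∣-trans d²∣x (ND.n∣m*n q)))
    no-square : squarefree x ≡ true → ∀ d → 2 ≤ d → ¬ d N.* d ∣ q N.* x
    no-square sf d 2≤d d²∣qx with ∃-prime-factor d 2≤d
    ... | r , pr , r∣d with r ≟ q
    ... | yes refl = q∤x (ND.*-cancelˡ-∣ q {{NPr.prime⇒nonZero pq}} (ND.∣-trans (ND.*-pres-∣ r∣d r∣d) d²∣qx))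
    ... | no r≢q = squarefree⇒ 1≤x sf (prime⇒≥2 pr) (prime²∣*⇒∣ pr pq r≢q (ND.∣-trans (ND.*-pres-∣ r∣d r∣d) d²∣qx))
    from : squarefree x ≡ true → squarefree (q N.* x) ≡ true
    from sf = squarefree⇐ (no-square sf)

  allSmall-q* : ∀ {q} x → Prime q → Small q → 1 ≤ x → allSmall (q N.* x) ≡ allSmall x
  allSmall-q* {q} x pq sq 1≤x = true⇔true⇒≡ to from
    where
    to : allSmall (q N.* x) ≡ true → allSmall x ≡ true
    to h = allSmall⇐ (λ p pp p∣x → allSmall⇒ (NP.*-mono-≤ (NP.≤-trans (s≤s z≤n) (prime⇒≥2 pq)) 1≤x) h pp
                                              (ND.∣-trans p∣x (ND.n∣m*n q)))
    from : allSmall x ≡ true → allSmall (q N.* x) ≡ true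
    from h = allSmall⇐ (λ p pp p∣qx → [ (λ p∣q → subst Small (sym (prime∣prime⇒≡ pp pq p∣q)) sq)
                                      , (λ p∣x → allSmall⇒ 1≤x h pp p∣x) ]′ (euclidsLemma q x pp p∣qx))

  ω-q* : ∀ {q} x → Prime q → 1 ≤ x → ¬ q ∣ x → ω (q N.* x) ≡ suc (ω x)
  ω-q* {q} x pq 1≤x q∤x = ℕtoℚ-injective _ _ (begin
    ℕtoℚ (ω n)
      ≡⟨ count-oneTo (λ d → d ∣? n) (λ p → prime? p) n ⟩
    ∑[ i < n ] primeDivisorOf n (suc i)
      ≡⟨ ∑-cong n (λ i _ → primeDivisorOf-q* (suc i)) ⟩
    ∑[ i < n ] (primeDivisorOf x (suc i) + when ⌊ q ≟ suc i ⌋ 1ℚ)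
      ≡⟨ ∑-+ n _ _ ⟩
    ∑[ i < n ] primeDivisorOf x (suc i) + ∑[ i < n ] when ⌊ q ≟ suc i ⌋ 1ℚ
      ≡⟨ cong₂ _+_ (trans (∑-extend x n _ x≤n beyond-x) (sym (count-oneTo (λ d → d ∣? x) (λ p → prime? p) x)))
                   (trans (∑-indicator n q (λ _ → 1ℚ) (NP.≤-trans (s≤s z≤n) (prime⇒≥2 pq)))
                          (when-yes (q ≤? n) (NP.m≤m*n q x {{N.>-nonZero 1≤x}}) 1ℚ)) ⟩
    ℕtoℚ (ω x) + 1ℚ
      ≡⟨ trans (QP.+-comm (ℕtoℚ (ω x)) 1ℚ) (sym (ℕtoℚ-suc (ω x))) ⟩
    ℕtoℚ (suc (ω x)) ∎)
    where
    open ≡-Reasoning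
    n : ℕ
    n = q N.* x
    x≤n : x ≤ n
    x≤n = NP.m≤n*m x q {{NPr.prime⇒nonZero pq}}
    primeDivisorOf : ℕ → ℕ → ℚ
    primeDivisorOf m d = when ⌊ d ∣? m ⌋ (when ⌊ prime? d ⌋ 1ℚ)
    beyond-x : ∀ i → x ≤ i → i < n → primeDivisorOf x (suc i) ≡ 0ℚ
    beyond-x i x≤i _ = when-no (suc i ∣? x) (λ d∣x → NP.<-irrefl refl (NP.≤-trans (ND.∣⇒≤ {{N.>-nonZero 1≤x}} d∣x) x≤i)) _
    primeDivisorOf-q* : ∀ d → primeDivisorOf n d ≡ primeDivisorOf x d + when ⌊ q ≟ d ⌋ 1ℚ
    primeDivisorOf-q* d with prime? d | q ≟ d
    ... | no ¬pd | yes refl = ⊥-elim (¬pd pq)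
    ... | no _ | no _ = trans (when-zero ⌊ d ∣? n ⌋) (sym (trans (QP.+-identityʳ _) (when-zero ⌊ d ∣? x ⌋)))
    ... | yes _ | yes refl = trans (when-yes (q ∣? n) (ND.m∣m*n x) 1ℚ)
                                   (sym (trans (cong (_+ 1ℚ) (when-no (q ∣? x) q∤x 1ℚ)) (QP.+-identityˡ 1ℚ)))
    ... | yes pd | no q≢d = trans (when-⇔ (d ∣? n) (d ∣? x) d∣n⇒d∣x (λ d∣x → ND.∣-trans d∣x (ND.n∣m*n q)) 1ℚ)
                                  (sym (QP.+-identityʳ _))
      where
      d∣n⇒d∣x : d ∣ n → d ∣ x
      d∣n⇒d∣x d∣n = [ (λ d∣q → ⊥-elim (q≢d (sym (prime∣prime⇒≡ pd pq d∣q)))) , id ]′ (euclidsLemma q x pd d∣n)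

  μ-q* : ∀ {q} x → Prime q → Small q → 1 ≤ x → ¬ q ∣ x → μ (q N.* x) ≡ - μ x
  μ-q* x pq sq 1≤x q∤x =
    trans (cong₂ (λ b w → when b (sgn w)) (cong₂ _∧_ (squarefree-q* x pq 1≤x q∤x) (allSmall-q* x pq sq 1≤x)) (ω-q* x pq 1≤x q∤x))
          (trans (cong (when b) (sgn-suc (ω x))) (when-neg b (sgn (ω x))))
    where
    b : Bool
    b = squarefree x ∧ allSmall x

  divisorTerm : ℕ → ℕ → ℚ
  divisorTerm n d = when ⌊ d ∣? n ⌋ (μ d * 1ℚ)

  g-unfold : ∀ n → g n ≡ ∑[ k < n ] divisorTerm n (suc k)
  g-unfold n = trans (⋆-comm 𝟙 μ n) (⋆-unfold μ 𝟙 n)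

  -- The divisors q d with q ∤ d cancel the divisors d, because μ (q d) = - μ d.
  g-small-factor : ∀ {q} n → Prime q → Small q → 1 ≤ n → q ∣ n → g n ≡ 0ℚ
  g-small-factor {q} n pq sq 1≤n q∣n = begin
    g n
      ≡⟨ g-unfold n ⟩
    ∑[ k < n ] divisorTerm n (suc k)
      ≡⟨ ∑-cong n (λ k _ → when-split ⌊ q ∣? suc k ⌋ (divisorTerm n (suc k))) ⟩
    ∑[ k < n ] (when ⌊ q ∣? suc k ⌋ (divisorTerm n (suc k)) + coprimeTerm k)
      ≡⟨ ∑-+ n _ coprimeTerm ⟩
    ∑[ k < n ] when ⌊ q ∣? suc k ⌋ (divisorTerm n (suc k)) + ∑< n coprimeTerm
      ≡⟨ cong (_+ ∑< n coprimeTerm) multiples ⟩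
    - ∑< n coprimeTerm + ∑< n coprimeTerm
      ≡⟨ QP.+-inverseˡ (∑< n coprimeTerm) ⟩
    0ℚ ∎
    where
    open ≡-Reasoning
    coprimeTerm : ℕ → ℚ
    coprimeTerm k = when (not ⌊ q ∣? suc k ⌋) (divisorTerm n (suc k))
    q*-∣⇔ : ∀ {d} → ¬ q ∣ d → d ∣ n → q N.* d ∣ n
    q*-∣⇔ {d} q∤d (divides y n≡yd) with euclidsLemma y d pq (subst (q ∣_) n≡yd q∣n)
    ... | inj₁ (divides z y≡zq) = divides z (trans n≡yd (trans (cong (N._* d) y≡zq) (NP.*-assoc z q d)))
    ... | inj₂ q∣d = ⊥-elim (q∤d q∣d)
    multiple-term : ∀ x → divisorTerm n (q N.* suc x) ≡ - coprimeTerm x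
    multiple-term x = by-cases (q ∣? suc x)
      (λ q∣x' → trans (trans (cong (when _) (*-zeroˡ-≡ 1ℚ (μ-q*-∣ (suc x) pq (s≤s z≤n) q∣x'))) (when-zero _))
                      (sym (cong (λ b → - when (not b) (divisorTerm n (suc x))) (⌊⌋-true (q ∣? suc x) q∣x'))))
      (λ q∤x' → begin
        when ⌊ q N.* suc x ∣? n ⌋ (μ (q N.* suc x) * 1ℚ)
          ≡⟨ cong (λ v → when ⌊ q N.* suc x ∣? n ⌋ (v * 1ℚ)) (μ-q* (suc x) pq sq (s≤s z≤n) q∤x') ⟩
        when ⌊ q N.* suc x ∣? n ⌋ (- μ (suc x) * 1ℚ)
          ≡⟨ when-⇔ (q N.* suc x ∣? n) (suc x ∣? n) (ND.∣-trans (ND.n∣m*n q)) (q*-∣⇔ q∤x') _ ⟩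
        when ⌊ suc x ∣? n ⌋ (- μ (suc x) * 1ℚ)
          ≡⟨ trans (cong (when ⌊ suc x ∣? n ⌋) (sym (QP.neg-distribˡ-* (μ (suc x)) 1ℚ))) (when-neg ⌊ suc x ∣? n ⌋ _) ⟩
        - divisorTerm n (suc x)
          ≡⟨ sym (cong (λ b → - when (not b) (divisorTerm n (suc x))) (⌊⌋-false (q ∣? suc x) q∤x')) ⟩
        - coprimeTerm x ∎)
    multiples : ∑[ k < n ] when ⌊ q ∣? suc k ⌋ (divisorTerm n (suc k)) ≡ - ∑< n coprimeTerm
    multiples = trans (∑-multiples n q {{NPr.prime⇒nonZero pq}} (divisorTerm n)
                         (λ d n<d → when-no (d ∣? n) (λ d∣n → NP.<⇒≱ n<d (ND.∣⇒≤ {{N.>-nonZero 1≤n}} d∣n)) _))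
                      (trans (∑-cong n (λ x _ → multiple-term x)) (∑-neg n coprimeTerm))

  g-no-small-factor : ∀ n → 1 ≤ n → (∀ p → Prime p → p ∣ n → ¬ Small p) → g n ≡ 1ℚ
  g-no-small-factor n@(suc m) _ large = begin
    g n
      ≡⟨ trans (g-unfold n) (∑-suc-front m _) ⟩
    divisorTerm n 1 + ∑[ k < m ] divisorTerm n (suc (suc k))
      ≡⟨ cong₂ _+_ (when-yes (1 ∣? n) (ND.1∣ n) (μ 1 * 1ℚ)) (∑-zero m (λ k _ → nontrivial-divisor (suc (suc k)) (s≤s (s≤s z≤n)))) ⟩
    1ℚ + 0ℚ
      ≡⟨ QP.+-identityʳ 1ℚ ⟩
    1ℚ ∎
    where
    open ≡-Reasoning
    nontrivial-divisor : ∀ d → 2 ≤ d → divisorTerm n d ≡ 0ℚ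
    nontrivial-divisor d 2≤d with ∃-prime-factor d 2≤d
    ... | r , pr , r∣d = by-cases (d ∣? n)
      (λ d∣n → trans (cong (when _) (*-zeroˡ-≡ 1ℚ (μ-not-allSmall d (¬true⇒false _ (λ h →
                 large r pr (ND.∣-trans r∣d d∣n) (allSmall⇒ (NP.≤-trans (s≤s z≤n) 2≤d) h pr r∣d))))))
                     (when-zero _))
      (λ d∤n → when-no (d ∣? n) d∤n _)

  SmallFactor : ℕ → Set
  SmallFactor n = ∃[ p ] (p < suc n × Prime p × p ∣ n × Small p)

  smallFactor? : ∀ n → Dec (SmallFactor n)
  smallFactor? n = NP.anyUpTo? (λ p → prime? p ×-dec (p ∣? n ×-dec (p N.^ t ≤? N))) (suc n)

  g-large-prime-power-* : ∀ {q} → Prime q → ¬ Small q → ∀ j k → g (suc k) ≡ g (q N.^ suc j N.* suc k)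
  g-large-prime-power-* {q} pq large-q j k = by-cases (smallFactor? (suc k))
    (λ { (p , _ , pp , p∣k' , sp) →
      trans (g-small-factor (suc k) pp sp (s≤s z≤n) p∣k')
            (sym (g-small-factor n pp sp 1≤n (ND.∣-trans p∣k' (ND.n∣m*n (q N.^ suc j))))) })
    (λ ¬sf →
      trans (g-no-small-factor (suc k) (s≤s z≤n) (λ p pp p∣k' sp → ¬sf (p , s≤s (ND.∣⇒≤ p∣k') , pp , p∣k' , sp)))
            (sym (g-no-small-factor n 1≤n (λ p pp p∣n sp →
              [ (λ p∣q^ → large-q (subst Small (prime∣^⇒≡ (suc j) pp pq p∣q^) sp))
              , (λ p∣k' → ¬sf (p , s≤s (ND.∣⇒≤ p∣k') , pp , p∣k' , sp)) ]′ (euclidsLemma (q N.^ suc j) (suc k) pp p∣n)))))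
    where
    n : ℕ
    n = q N.^ suc j N.* suc k
    1≤n : 1 ≤ n
    1≤n = NP.*-mono-≤ (NP.m^n>0 q {{NPr.prime⇒nonZero pq}} (suc j)) (s≤s z≤n)

  f-vanishes : ∀ e → e N.^ t ≤ N → fN N t e ≡ 0ℚ
  f-vanishes zero _ = refl
  f-vanishes (suc zero) _ = refl
  f-vanishes e@(suc (suc _)) e^t≤N with ∃-prime-factor e (s≤s (s≤s z≤n))
  ... | p , pp , p∣e = cong (_- 0ℚ) (g-small-factor e pp (NP.≤-trans (NP.^-monoˡ-≤ t (ND.∣⇒≤ p∣e)) e^t≤N) (s≤s z≤n) p∣e)

⋆-support : ∀ (a b : ArithFun) A B t → (∀ d → a d ≢ 0ℚ → A ≤ d N.^ t) → (∀ d → b d ≢ 0ℚ → B < d N.^ t) →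
  ∀ n → (a ⋆ b) n ≢ 0ℚ → A N.* B < n N.^ t
⋆-support a b A B t a-support b-support n ne with ⋆-≢0 a b n ne
... | i , i∣n , a≢0 , b≢0 = begin-strict
  A N.* B                        ≤⟨ NP.*-monoˡ-≤ B (a-support (suc i) a≢0) ⟩
  S N.* B                        <⟨ NP.*-monoʳ-< S {{NP.m^n≢0 (suc i) t}} (b-support (n / suc i) b≢0) ⟩
  S N.* (n / suc i) N.^ t        ≡⟨ sym (^-distribʳ-* (suc i) (n / suc i) t) ⟩
  (suc i N.* (n / suc i)) N.^ t  ≡⟨ cong (N._^ t) (NDM.m*[n/m]≡n i∣n) ⟩
  n N.^ t                        ∎
  where
  open NP.≤-Reasoning
  S : ℕ
  S = suc i N.^ t

powerIndicator : ℕ → ℚ → ArithFun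
powerIndicator q r d = ∑[ j < d ] when ⌊ q N.^ suc j ≟ d ⌋ r

powerIndicator-extend : ∀ {q} → Prime q → ∀ r i n → i < n →
  powerIndicator q r (suc i) ≡ ∑[ j < n ] when ⌊ q N.^ suc j ≟ suc i ⌋ r
powerIndicator-extend {q} pq r i n i<n = sym (∑-extend (suc i) n _ i<n (λ j i<j _ →
  when-no (q N.^ suc j ≟ suc i) (λ e → NP.<-irrefl refl
    (NP.≤-trans (subst (suc (suc j) ≤_) e (n<m^n (prime⇒≥2 pq) (suc j))) (NP.m≤n⇒m≤1+n i<j))) r))

powerIndicator-power : ∀ {q} → Prime q → ∀ r v → powerIndicator q r (q N.^ suc v) ≡ r
powerIndicator-power {q} pq r v =
  trans (∑-single (q N.^ suc v) v _ (NP.<-trans (NP.n<1+n v) (n<m^n (prime⇒≥2 pq) (suc v)))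
                  (λ j _ j≢v → when-no (q N.^ suc j ≟ q N.^ suc v) (λ e → j≢v (NP.suc-injective (^-injective pq _ _ e))) r))
        (when-yes (q N.^ suc v ≟ q N.^ suc v) refl r)

powerIndicator-non-power : ∀ q r n → (∀ j → q N.^ suc j ≢ n) → powerIndicator q r n ≡ 0ℚ
powerIndicator-non-power q r n non-power = ∑-zero n (λ j _ → when-no (q N.^ suc j ≟ n) (non-power j) r)

powerIndicator-⋆ : ∀ {q} → Prime q → ∀ (r : ℚ) (G : ArithFun) n → 1 ≤ n →
  (∀ j k → q N.^ suc j N.* suc k ≡ n → r * G (suc k) ≡ r * G n) →
  (powerIndicator q r ⋆ G) n ≡ r * (ν q n * G n)
powerIndicator-⋆ {q} pq r G n 1≤n G-invariant = begin
  (powerIndicator q r ⋆ G) n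
    ≡⟨ ⋆-as-pairs (powerIndicator q r) G n n NP.≤-refl ⟩
  ∑[ i < n ] ∑[ k < n ] when ⌊ suc i N.* suc k ≟ n ⌋ (powerIndicator q r (suc i) * G (suc k))
    ≡⟨ ∑-cong n (λ i i<n → ∑-cong n (λ k _ → expand i k i<n)) ⟩
  ∑[ i < n ] ∑[ k < n ] ∑[ j < n ] when ⌊ suc i N.* suc k ≟ n ⌋ (when ⌊ q N.^ suc j ≟ suc i ⌋ r * G (suc k))
    ≡⟨ ∑-rotate n _ ⟩
  ∑[ k < n ] ∑[ j < n ] ∑[ i < n ] when ⌊ suc i N.* suc k ≟ n ⌋ (when ⌊ q N.^ suc j ≟ suc i ⌋ r * G (suc k))
    ≡⟨ ∑-cong n (λ k _ → ∑-cong n (λ j _ → trans (∑-factor-collapse n (q N.^ suc j) k r (G (suc k)) (q^>0 j))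
                                                (invariant j k))) ⟩
  ∑[ k < n ] ∑[ j < n ] when ⌊ q N.^ suc j N.* suc k ≟ n ⌋ (r * G n)
    ≡⟨ ∑-comm n n _ ⟩
  ∑[ j < n ] ∑[ k < n ] when ⌊ q N.^ suc j N.* suc k ≟ n ⌋ (r * G n)
    ≡⟨ ∑-cong n (λ j _ → sym (∣-indicator (q N.^ suc j) n n (λ _ → r * G n) {{q^≢0 j}} 1≤n NP.≤-refl)) ⟩
  ∑[ j < n ] when ⌊ q N.^ suc j ∣? n ⌋ (r * G n)
    ≡⟨ ∑-cong n (λ j _ → sym (trans (when-*ʳ _ 1ℚ (r * G n)) (cong (when _) (QP.*-identityˡ (r * G n))))) ⟩
  ∑[ j < n ] (when ⌊ q N.^ suc j ∣? n ⌋ 1ℚ * (r * G n))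
    ≡⟨ ∑-*ʳ n (r * G n) _ ⟩
  ν q n * (r * G n)
    ≡⟨ QR.solve 3 (λ v r g → v QR.:* (r QR.:* g) QR.:= r QR.:* (v QR.:* g)) refl (ν q n) r (G n) ⟩
  r * (ν q n * G n) ∎
  where
  open ≡-Reasoning
  q^≢0 : ∀ j → NonZero (q N.^ suc j)
  q^≢0 j = NP.m^n≢0 q (suc j) {{NPr.prime⇒nonZero pq}}
  q^>0 : ∀ j → 1 ≤ q N.^ suc j
  q^>0 j = NP.m^n>0 q {{NPr.prime⇒nonZero pq}} (suc j)
  expand : ∀ i k → i < n → when ⌊ suc i N.* suc k ≟ n ⌋ (powerIndicator q r (suc i) * G (suc k))
                           ≡ ∑[ j < n ] when ⌊ suc i N.* suc k ≟ n ⌋ (when ⌊ q N.^ suc j ≟ suc i ⌋ r * G (suc k))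
  expand i k i<n = trans (cong (when ⌊ suc i N.* suc k ≟ n ⌋)
                               (trans (cong (_* G (suc k)) (powerIndicator-extend pq r i n i<n)) (sym (∑-*ʳ n (G (suc k)) _))))
                         (when-∑ _ n _)
  invariant : ∀ j k → when ⌊ q N.^ suc j N.* suc k ≟ n ⌋ (r * G (suc k)) ≡ when ⌊ q N.^ suc j N.* suc k ≟ n ⌋ (r * G n)
  invariant j k with q N.^ suc j N.* suc k ≟ n
  ... | yes e = G-invariant j k e
  ... | no _ = refl

module RoughLog (N T : ℕ) where

  t : ℕ
  t = suc T

  open Rough N t

  f : ArithFun
  f = fN N t

  open TruncatedLog f refl using (log; convPow-suc)

  g≡δ₁+f : ∀ m → g m ≡ δ₁ m + f m
  g≡δ₁+f m = QR.solve 2 (λ g d → g QR.:= d QR.:+ (g QR.:- d)) refl (g m) (δ₁ m)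

  f-support : ∀ d → f d ≢ 0ℚ → N < d N.^ t
  f-support d f≢0 = NP.≰⇒> (λ d^t≤N → f≢0 (f-vanishes d d^t≤N))

  convPow-support : ∀ k d → convPow f k d ≢ 0ℚ → N N.^ k ≤ d N.^ t
  convPow-support zero zero ne = ⊥-elim (ne refl)
  convPow-support zero (suc zero) _ = NP.≤-reflexive (sym (NP.^-zeroˡ t))
  convPow-support zero (suc (suc d)) ne = ⊥-elim (ne refl)
  convPow-support (suc zero) d ne = subst (_≤ d N.^ t) (sym (NP.*-identityʳ N)) (NP.<⇒≤ (f-support d ne))
  convPow-support (suc (suc k)) d ne = NP.<⇒≤ (subst (_< d N.^ t) (NP.*-comm (N N.^ suc k) N)
    (⋆-support (convPow f (suc k)) f (N N.^ suc k) N t (convPow-support (suc k)) f-support d ne))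

  convPow-T-⋆-vanishes : ∀ (h : ArithFun) → (∀ d → f d ≡ 0ℚ → h d ≡ 0ℚ) → ∀ n → n ≤ N → (convPow f T ⋆ h) n ≡ 0ℚ
  convPow-T-⋆-vanishes h f≡0⇒h≡0 n n≤N with (convPow f T ⋆ h) n QP.≟ 0ℚ
  ... | yes ≡0 = ≡0
  ... | no ≢0 = ⊥-elim (NP.<-irrefl refl (NP.<-≤-trans N^t<n^t (NP.^-monoˡ-≤ t n≤N)))
    where
    N^t<n^t : N N.^ t < n N.^ t
    N^t<n^t = subst (_< n N.^ t) (NP.*-comm (N N.^ T) N)
      (⋆-support (convPow f T) h (N N.^ T) N t (convPow-support T) (λ d h≢0 → f-support d (λ f≡0 → h≢0 (f≡0⇒h≡0 d f≡0))) n ≢0)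

  weight : ℕ → ℚ
  weight q = when (not ⌊ q N.^ t ≤? N ⌋) 1ℚ

  weight-small : ∀ {q} → Small q → weight q ≡ 0ℚ
  weight-small {q} sq = cong (λ b → when (not b) 1ℚ) (⌊⌋-true (q N.^ t ≤? N) sq)

  weight-large : ∀ {q} → ¬ Small q → weight q ≡ 1ℚ
  weight-large {q} ¬sq = cong (λ b → when (not b) 1ℚ) (⌊⌋-false (q N.^ t ≤? N) ¬sq)

  module _ {q} (pq : Prime q) where
    open TruncatedLog.Derivation f refl (ν q) (ν-additive pq) using (Df; D-log-⋆-exp)

    D-log-⋆-g : ∀ n → n ≤ N → (D (ν q) (log T) ⋆ g) n ≡ Df n
    D-log-⋆-g n n≤N = begin
      (D (ν q) (log T) ⋆ g) n
        ≡⟨ D-log-⋆-exp T g g≡δ₁+f n ⟩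
      Df n - sgn T * (convPow f T ⋆ Df) n
        ≡⟨ cong (λ z → Df n - sgn T * z) (convPow-T-⋆-vanishes Df (λ d f≡0 → *-zeroˡ-≡ (ν q d) f≡0) n n≤N) ⟩
      Df n - sgn T * 0ℚ
        ≡⟨ QR.solve 2 (λ x s → x QR.:- s QR.:* QR.con 0ℚ QR.:= x) refl (Df n) (sgn T) ⟩
      Df n ∎
      where open ≡-Reasoning

    powerIndicator-⋆-g : ∀ n → 1 ≤ n → (powerIndicator q (weight q) ⋆ g) n ≡ Df n
    powerIndicator-⋆-g n 1≤n = begin
      (powerIndicator q (weight q) ⋆ g) n
        ≡⟨ powerIndicator-⋆ pq (weight q) g n 1≤n g-invariant ⟩
      weight q * (ν q n * g n)
        ≡⟨ weight-irrelevant ⟩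
      ν q n * g n
        ≡⟨ QR.solve 3 (λ v g d → v QR.:* g QR.:= (g QR.:- d) QR.:* v QR.:+ d QR.:* v) refl (ν q n) (g n) (δ₁ n) ⟩
      Df n + δ₁ n * ν q n
        ≡⟨ trans (cong (_+_ (Df n)) (δ₁ν≡0 n 1≤n)) (QP.+-identityʳ (Df n)) ⟩
      Df n ∎
      where
      open ≡-Reasoning
      g-invariant : ∀ j k → q N.^ suc j N.* suc k ≡ n → weight q * g (suc k) ≡ weight q * g n
      g-invariant j k e = by-cases (q N.^ t ≤? N)
        (λ sq → trans (*-zeroˡ-≡ _ (weight-small {q} sq)) (sym (*-zeroˡ-≡ _ (weight-small {q} sq))))
        (λ ¬sq → cong (weight q *_) (trans (g-large-prime-power-* pq ¬sq j k) (cong g e)))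
      weight-irrelevant : weight q * (ν q n * g n) ≡ ν q n * g n
      weight-irrelevant = by-cases (q N.^ t ≤? N)
        (λ sq → trans (*-zeroˡ-≡ _ (weight-small {q} sq)) (sym (by-cases (q ∣? n)
           (λ q∣n → *-zeroʳ-≡ (ν q n) (g-small-factor n pq sq 1≤n q∣n))
           (λ q∤n → *-zeroˡ-≡ (g n) (ν-∤ q n q∤n)))))
        (λ ¬sq → trans (cong (_* (ν q n * g n)) (weight-large {q} ¬sq)) (QP.*-identityˡ (ν q n * g n)))
      δ₁ν≡0 : ∀ n → 1 ≤ n → δ₁ n * ν q n ≡ 0ℚ
      δ₁ν≡0 (suc zero) _ = trans (QP.*-identityˡ (ν q 1)) (ν-1 pq)
      δ₁ν≡0 (suc (suc k)) _ = QP.*-zeroˡ (ν q (suc (suc k)))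

    log-*-ν : ∀ n → 1 ≤ n → n ≤ N → log T n * ν q n ≡ powerIndicator q (weight q) n
    log-*-ν = λ n 1≤n n≤N → -≡0⇒≡ _ _ (⋆-cancelʳ-zero h g N refl h⋆g≡0 n 1≤n n≤N)
      where
      h : ArithFun
      h m = D (ν q) (log T) m - powerIndicator q (weight q) m
      h⋆g≡0 : ∀ n → n ≤ N → (h ⋆ g) n ≡ 0ℚ
      h⋆g≡0 zero _ = ⋆-unfold h g 0
      h⋆g≡0 n@(suc _) n≤N =
        trans (⋆-distribʳ-+ (D (ν q) (log T)) (λ m → - powerIndicator q (weight q) m) g n)
        (trans (cong₂ _+_ (D-log-⋆-g n n≤N) (trans (⋆-negˡ (powerIndicator q (weight q)) g n)
                                                   (cong -_ (powerIndicator-⋆-g n (s≤s z≤n)))))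
               (QP.+-inverseʳ (Df n)))

  largePrime : ℕ → ℚ
  largePrime p = when ⌊ prime? p ⌋ (weight p)

  logValue : ℕ → ℚ
  logValue n = ∑[ j < T ] (inv (suc j) * ∑[ p < N ] when ⌊ suc p N.^ suc j ≟ n ⌋ (largePrime (suc p)))

  logValue-via : ∀ {q} → Prime q → ∀ n → q ∣ n → q ≤ N →
    logValue n ≡ ∑[ j < T ] when ⌊ q N.^ suc j ≟ n ⌋ (inv (suc j) * weight q)
  logValue-via {zero} pq = ⊥-elim (NPr.¬prime[0] pq)
  logValue-via {q@(suc q-1)} pq n q∣n q≤N =
    ∑-cong T (λ j _ → trans (cong (inv (suc j) *_) (only-q j)) (when-*ˡ _ (weight q) (inv (suc j))))
    where
    only-q : ∀ j → ∑[ p < N ] when ⌊ suc p N.^ suc j ≟ n ⌋ (largePrime (suc p)) ≡ when ⌊ q N.^ suc j ≟ n ⌋ (weight q)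
    only-q j = trans (∑-single N q-1 _ q≤N (λ p _ p≢q-1 → other p p≢q-1))
                     (cong (when ⌊ q N.^ suc j ≟ n ⌋) (when-yes (prime? q) pq (weight q)))
      where
      other : ∀ p → p ≢ q-1 → when ⌊ suc p N.^ suc j ≟ n ⌋ (largePrime (suc p)) ≡ 0ℚ
      other p p≢q-1 = by-cases (prime? (suc p))
        (λ pp → when-no (suc p N.^ suc j ≟ n)
                  (λ e → p≢q-1 (NP.suc-injective (sym (prime∣^⇒≡ (suc j) pq pp (subst (q ∣_) (sym e) q∣n))))) _)
        (λ ¬pp → trans (cong (when ⌊ suc p N.^ suc j ≟ n ⌋) (when-no (prime? (suc p)) ¬pp (weight (suc p)))) (when-zero _))

  log≡logValue-1 : log T 1 ≡ logValue 1
  log≡logValue-1 = trans (∑-zero T (λ j _ → *-zeroʳ-≡ (coeff (suc j)) (convPow-at-1 j)))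
                         (sym (∑-zero T (λ j _ → *-zeroʳ-≡ (inv (suc j)) (∑-zero N (λ p _ → no-power j p)))))
    where
    convPow-at-1 : ∀ k → convPow f (suc k) 1 ≡ 0ℚ
    convPow-at-1 k = trans (convPow-suc k 1) (trans (⋆-unfold (convPow f k) f 1)
      (trans (QP.+-identityˡ _) (trans (cong (when ⌊ 1 ∣? 1 ⌋) (QP.*-zeroʳ (convPow f k 1))) (when-zero ⌊ 1 ∣? 1 ⌋))))
    no-power : ∀ j p → when ⌊ suc p N.^ suc j ≟ 1 ⌋ (largePrime (suc p)) ≡ 0ℚ
    no-power j zero = when-zero _
    no-power j (suc p) = when-no (suc (suc p) N.^ suc j ≟ 1)
      (λ e → NP.<-irrefl (sym e) (NP.≤-trans (s≤s (s≤s z≤n)) (n<m^n (s≤s (s≤s z≤n)) (suc j)))) _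

  log≡logValue-power : ∀ {q} → Prime q → ∀ v → q N.^ suc v ≤ N → log T (q N.^ suc v) ≡ logValue (q N.^ suc v)
  log≡logValue-power {q} pq v n≤N = trans log-n (sym logValue-n)
    where
    n : ℕ
    n = q N.^ suc v
    q∤1 : ¬ q ∣ 1
    q∤1 q∣1 = NP.<-irrefl (sym (ND.∣1⇒≡1 q∣1)) (prime⇒≥2 pq)
    ν-n : ν q n ≡ ℕtoℚ (suc v)
    ν-n = trans (cong (ν q) (sym (NP.*-identityʳ n))) (ν-power-split pq (suc v) 1 q∤1 NP.≤-refl)
    log-n : log T n ≡ weight q * inv (suc v)
    log-n = *-ℕtoℚ-cancel _ _ v (trans (cong (log T n *_) (sym ν-n))
              (trans (log-*-ν pq n (NP.m^n>0 q {{NPr.prime⇒nonZero pq}} (suc v)) n≤N) (powerIndicator-power pq (weight q) v)))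
    unequal : ∀ j → j ≢ v → ¬ q N.^ suc j ≡ n
    unequal j j≢v e = j≢v (NP.suc-injective (^-injective pq _ _ e))
    logValue-n : logValue n ≡ weight q * inv (suc v)
    logValue-n = trans (logValue-via pq n (ND.m∣m*n (q N.^ v)) q≤N) (by-cases (v <? T) within-T beyond-T)
      where
      q≤N : q ≤ N
      q≤N = NP.≤-trans (NP.m≤m*n q (q N.^ v) {{NP.m^n≢0 q v {{NPr.prime⇒nonZero pq}}}}) n≤N
      within-T : v < T → ∑[ j < T ] when ⌊ q N.^ suc j ≟ n ⌋ (inv (suc j) * weight q) ≡ weight q * inv (suc v)
      within-T v<T = trans (∑-single T v _ v<T (λ j _ j≢v → when-no (q N.^ suc j ≟ n) (unequal j j≢v) _))
                           (trans (when-yes (q N.^ suc v ≟ n) refl _) (QP.*-comm (inv (suc v)) (weight q)))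
      beyond-T : ¬ v < T → ∑[ j < T ] when ⌊ q N.^ suc j ≟ n ⌋ (inv (suc j) * weight q) ≡ weight q * inv (suc v)
      beyond-T v≮T = trans (∑-zero T (λ j j<T → when-no (q N.^ suc j ≟ n) (unequal j (λ j≡v → v≮T (subst (_< T) j≡v j<T))) _))
                           (sym (*-zeroˡ-≡ (inv (suc v)) (weight-small {q} q-small)))
        where
        q-small : Small q
        q-small = NP.≤-trans (NP.^-monoʳ-≤ q {{NPr.prime⇒nonZero pq}} (s≤s (NP.≮⇒≥ v≮T))) n≤N

  log≡logValue-composite : ∀ {q} → Prime q → ∀ v m → 2 ≤ m → ¬ q ∣ m → q N.^ suc v N.* m ≤ N →
    log T (q N.^ suc v N.* m) ≡ logValue (q N.^ suc v N.* m)
  log≡logValue-composite {q} pq v m 2≤m q∤m n≤N = trans log-n (sym logValue-n)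
    where
    n : ℕ
    n = q N.^ suc v N.* m
    1≤n : 1 ≤ n
    1≤n = NP.*-mono-≤ (NP.m^n>0 q {{NPr.prime⇒nonZero pq}} (suc v)) (NP.≤-trans (s≤s z≤n) 2≤m)
    q∣n : q ∣ n
    q∣n = ND.∣-trans (ND.m∣m*n (q N.^ v)) (ND.m∣m*n m)
    not-power : ∀ {p} j → Prime p → p N.^ suc j ≢ n
    not-power {p} j pp e with ∃-prime-factor m 2≤m
    ... | r , pr , r∣m = q∤m (subst (_∣ m) (trans r≡p (sym q≡p)) r∣m)
      where
      r≡p : r ≡ p
      r≡p = prime∣^⇒≡ (suc j) pr pp (subst (r ∣_) (sym e) (ND.∣-trans r∣m (ND.n∣m*n (q N.^ suc v))))
      q≡p : q ≡ p
      q≡p = prime∣^⇒≡ (suc j) pq pp (subst (q ∣_) (sym e) q∣n)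
    log-n : log T n ≡ 0ℚ
    log-n = trans (*-ℕtoℚ-cancel _ 0ℚ v (trans (cong (log T n *_) (sym (ν-power-split pq (suc v) m q∤m (NP.≤-trans (s≤s z≤n) 2≤m))))
                                        (trans (log-*-ν pq n 1≤n n≤N) (powerIndicator-non-power q _ n (λ j → not-power j pq)))))
                  (QP.*-zeroˡ (inv (suc v)))
    logValue-n : logValue n ≡ 0ℚ
    logValue-n = trans (logValue-via pq n q∣n (NP.≤-trans (ND.∣⇒≤ {{N.>-nonZero 1≤n}} q∣n) n≤N))
                       (∑-zero T (λ j _ → when-no (q N.^ suc j ≟ n) (not-power j pq) _))

  log≡logValue : ∀ n → 1 ≤ n → n ≤ N → log T n ≡ logValue n
  log≡logValue (suc zero) _ _ = log≡logValue-1
  log≡logValue n@(suc (suc _)) _ n≤N with ∃-prime-factor n (s≤s (s≤s z≤n))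
  ... | q , pq , q∣n with powerSplit pq n (s≤s z≤n)
  ... | zero , m , n≡m , q∤m = ⊥-elim (q∤m (subst (q ∣_) (trans n≡m (NP.*-identityˡ m)) q∣n))
  ... | suc v , zero , n≡0 , _ = ⊥-elim (NP.1+n≢0 (trans n≡0 (NP.*-zeroʳ (q N.^ suc v))))
  ... | suc v , suc zero , n≡q^ , _ =
    subst (λ x → log T x ≡ logValue x) (sym (trans n≡q^ (NP.*-identityʳ _)))
          (log≡logValue-power pq v (subst (_≤ N) (trans n≡q^ (NP.*-identityʳ _)) n≤N))
  ... | suc v , m@(suc (suc _)) , n≡ , q∤m =
    subst (λ x → log T x ≡ logValue x) (sym n≡) (log≡logValue-composite pq v m (s≤s (s≤s z≤n)) q∤m (subst (_≤ N) n≡ n≤N))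

  πroot-as-∑ : ∀ k → ℕtoℚ (πroot N k) ≡ ∑[ p < N ] when ⌊ suc p N.^ k ≤? N ⌋ (when ⌊ prime? (suc p) ⌋ 1ℚ)
  πroot-as-∑ k = count-oneTo (λ p → p N.^ k ≤? N) (λ p → prime? p) N

  πroot-difference : ∀ k → k ≤ t →
    ℕtoℚ (πroot N k) - ℕtoℚ (πroot N t) ≡ ∑[ p < N ] when ⌊ suc p N.^ k ≤? N ⌋ (largePrime (suc p))
  πroot-difference k k≤t =
    trans (cong₂ _-_ (πroot-as-∑ k) (πroot-as-∑ t))
    (trans (cong (_+_ (∑< N (primeBelow k))) (sym (∑-neg N (primeBelow t))))
    (trans (sym (∑-+ N (primeBelow k) (λ p → - primeBelow t p))) (∑-cong N (λ p _ → difference p))))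
    where
    primeBelow : ℕ → ℕ → ℚ
    primeBelow k p = when ⌊ suc p N.^ k ≤? N ⌋ (when ⌊ prime? (suc p) ⌋ 1ℚ)
    difference : ∀ p → primeBelow k p - primeBelow t p ≡ when ⌊ suc p N.^ k ≤? N ⌋ (largePrime (suc p))
    difference p = by-cases (suc p N.^ t ≤? N)
      (λ small → begin
        primeBelow k p - primeBelow t p
          ≡⟨ cong₂ _-_ (when-yes (suc p N.^ k ≤? N) (NP.≤-trans (NP.^-monoʳ-≤ (suc p) k≤t) small) isPrime)
                       (when-yes (suc p N.^ t ≤? N) small isPrime) ⟩
        isPrime - isPrime
          ≡⟨ QP.+-inverseʳ isPrime ⟩
        0ℚ
          ≡⟨ sym (trans (cong (λ w → when ⌊ suc p N.^ k ≤? N ⌋ (when ⌊ prime? (suc p) ⌋ w)) (weight-small {suc p} small))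
                        (trans (cong (when ⌊ suc p N.^ k ≤? N ⌋) (when-zero ⌊ prime? (suc p) ⌋)) (when-zero _))) ⟩
        when ⌊ suc p N.^ k ≤? N ⌋ (largePrime (suc p)) ∎)
      (λ large → begin
        primeBelow k p - primeBelow t p
          ≡⟨ cong (_-_ (primeBelow k p)) (when-no (suc p N.^ t ≤? N) large isPrime) ⟩
        primeBelow k p - 0ℚ
          ≡⟨ QP.+-identityʳ (primeBelow k p) ⟩
        primeBelow k p
          ≡⟨ sym (cong (λ w → when ⌊ suc p N.^ k ≤? N ⌋ (when ⌊ prime? (suc p) ⌋ w)) (weight-large {suc p} large)) ⟩
        when ⌊ suc p N.^ k ≤? N ⌋ (largePrime (suc p)) ∎)
      where
      open ≡-Reasoning
      isPrime : ℚ
      isPrime = when ⌊ prime? (suc p) ⌋ 1ℚ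

  ∑-log : ∑[ i < N ] log T (suc i) ≡ ∑[ j < T ] (inv (suc j) * (ℕtoℚ (πroot N (suc j)) - ℕtoℚ (πroot N t)))
  ∑-log = begin
    ∑[ i < N ] log T (suc i)
      ≡⟨ ∑-cong N (λ i i<N → log≡logValue (suc i) (s≤s z≤n) i<N) ⟩
    ∑[ i < N ] logValue (suc i)
      ≡⟨ ∑-comm N T _ ⟩
    ∑[ j < T ] ∑[ i < N ] (inv (suc j) * ∑[ p < N ] when ⌊ suc p N.^ suc j ≟ suc i ⌋ (largePrime (suc p)))
      ≡⟨ ∑-cong T (λ j _ → trans (∑-*ˡ N (inv (suc j)) _) (cong (inv (suc j) *_) (trans (∑-comm N N _)
           (∑-cong N (λ p _ → ∑-indicator N (suc p N.^ suc j) (λ _ → largePrime (suc p)) (NP.m^n>0 (suc p) (suc j))))))) ⟩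
    ∑[ j < T ] (inv (suc j) * ∑[ p < N ] when ⌊ suc p N.^ suc j ≤? N ⌋ (largePrime (suc p)))
      ≡⟨ sym (∑-cong T (λ j j<T → cong (inv (suc j) *_) (πroot-difference (suc j) (s≤s (NP.<⇒≤ j<T))))) ⟩
    ∑[ j < T ] (inv (suc j) * (ℕtoℚ (πroot N (suc j)) - ℕtoℚ (πroot N t))) ∎
    where open ≡-Reasoning

-- The k = 1 term of the first sum is π(N) - π(N^{1/t}).
first-term-split : ∀ (π : ℕ → ℚ) T →
  π 1 ≡ (∑[ j < T ] (inv (suc j) * (π (suc j) - π (suc T))) + π (suc T))
        - ∑[ j < T ∸ 1 ] (inv (suc (suc j)) * (π (suc (suc j)) - π (suc T)))
first-term-split π zero = QR.solve 1 (λ a → a QR.:= (QR.con 0ℚ QR.:+ a) QR.:- QR.con 0ℚ) refl (π 1)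
first-term-split π (suc T) =
  trans (QR.solve 3 (λ a p y → a QR.:= ((QR.con 1ℚ QR.:* (a QR.:- p) QR.:+ y) QR.:+ p) QR.:- y) refl (π 1) (π (suc (suc T))) rest)
        (cong (λ z → (z + π (suc (suc T))) - rest) (sym (∑-suc-front T (λ j → inv (suc j) * (π (suc j) - π (suc (suc T)))))))
  where
  rest : ℚ
  rest = ∑[ j < T ] (inv (suc (suc j)) * (π (suc (suc j)) - π (suc (suc T))))

mainTheorem15 : (N t : ℕ) → N ≥ 1 → t ≥ 1 →
    let f = fN N t in
    ℕtoℚ (πroot N 1)
      ≡ (sumFromTo 1 N (λ n → sumFromTo 1 (t ∸ 1) (λ k → coeff k * convPow f k n))
         + ℕtoℚ (πroot N t))
        - sumFromTo 2 (t ∸ 1) (λ k → inv k * (ℕtoℚ (πroot N k) - ℕtoℚ (πroot N t)))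
mainTheorem15 N zero _ ()
mainTheorem15 N t@(suc T) _ _ = trans (first-term-split π T)
  (sym (cong₂ (λ x y → (x + π t) - y) log-sum (sumFromTo-2 T (λ k → inv k * (π k - π t)))))
  where
  π : ℕ → ℚ
  π k = ℕtoℚ (πroot N k)
  log-sum : sumFromTo 1 N (λ n → sumFromTo 1 T (λ k → coeff k * convPow (fN N t) k n))
              ≡ ∑[ j < T ] (inv (suc j) * (π (suc j) - π t))
  log-sum = trans (sumFromTo-1 N (λ n → sumFromTo 1 T (λ k → coeff k * convPow (fN N t) k n)))
    (trans (∑-cong N (λ i _ → sumFromTo-1 T (λ k → coeff k * convPow (fN N t) k (suc i)))) (RoughLog.∑-log N T))
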